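{- For $q\in\mathbb{C}$ with $|q|<1$, $$\sum_{i,j\ge0}\frac{q^{4ij+i+3j}}{(q;q)_{2i+1}(q;q)_{2j}}=\frac{(q^8;q^8)_\infty}{(q;q^2)_\infty^2\,(q^4;q^8)_\infty}.$$
   Context: For $|q|<1$: $(a;q)_\infty=\prod_{k\ge0}(1-aq^k)$ and, for integers $n\ge0$, $(a;q)_n=\prod_{k=0}^{n-1}(1-aq^k)$. -}

module Defs where

open import Data.Nat using (ℕ; zero; suc; _∸_; _≡ᵇ_)
  renaming (_+_ to _+ℕ_; _*_ to _*ℕ_)
open import Data.Nat.Divisibility using (_∣?_)
open import Data.Integer using (ℤ; 0ℤ; 1ℤ; _+_; _*_; _-_)
open import Data.Bool using (if_then_else_)
open import Relation.Nullary.Decidable using (does)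

PS : Set
PS = ℕ → ℤ

sumTo : ℕ → (ℕ → ℤ) → ℤ
sumTo zero    f = 0ℤ
sumTo (suc n) f = sumTo n f + f n

infixl 7 _⊛_
_⊛_ : PS → PS → PS
(f ⊛ g) n = sumTo (suc n) (λ k → f k * g (n ∸ k))

𝟙 : PS
𝟙 zero    = 1ℤ
𝟙 (suc _) = 0ℤ

mono : ℕ → PS
mono m n = if m ≡ᵇ n then 1ℤ else 0ℤ

oneMinus : ℕ → PS
oneMinus m n = 𝟙 n - mono m n

-- 1/(1 - q^k) = Σ_{t≥0} q^{kt}, used only for k ≥ 1
inv1m : ℕ → PS
inv1m k n = if does (k ∣? n) then 1ℤ else 0ℤ

prodTo : ℕ → (ℕ → PS) → PS
prodTo zero    F = 𝟙
prodTo (suc n) F = prodTo n F ⊛ F n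

-- Infinite product Π_{k≥0} F k, for factors with F k ≡ 1 mod q^(k+1)
-- (true for all uses below): the coefficient of q^n only depends on the
-- factors k ≤ n, so it is that coefficient of the truncated product.
infProd : (ℕ → PS) → PS
infProd F n = prodTo (suc n) F n

qPochFin : ℕ → ℕ → ℕ → PS
qPochFin a d m = prodTo m (λ k → oneMinus (a +ℕ d *ℕ k))

-- 1/(q^a;q^d)_m = Π_{k<m} 1/(1 - q^(a+dk))   (a ≥ 1)
qPochFinInv : ℕ → ℕ → ℕ → PS
qPochFinInv a d m = prodTo m (λ k → inv1m (a +ℕ d *ℕ k))

-- (q^a;q^d)_∞   (a, d ≥ 1)
qPochInf : ℕ → ℕ → PS
qPochInf a d = infProd (λ k → oneMinus (a +ℕ d *ℕ k))

-- 1/(q^a;q^d)_∞   (a, d ≥ 1)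
qPochInfInv : ℕ → ℕ → PS
qPochInfInv a d = infProd (λ k → inv1m (a +ℕ d *ℕ k))

-- Double sum Σ_{i,j≥0} T i j, for terms with T i j ≡ 0 mod q^(max i j):
-- coefficient of q^n only involves i, j ≤ n.
dsum : (ℕ → ℕ → PS) → PS
dsum T n = sumTo (suc n) (λ i → sumTo (suc n) (λ j → T i j n))

summand : ℕ → ℕ → PS
summand i j = mono (4 *ℕ i *ℕ j +ℕ i +ℕ 3 *ℕ j)
              ⊛ qPochFinInv 1 1 (2 *ℕ i +ℕ 1)
              ⊛ qPochFinInv 1 1 (2 *ℕ j)

LHS : PS
LHS = dsum summand

RHS : PS
RHS = qPochInf 8 8 ⊛ (qPochInfInv 1 2 ⊛ qPochInfInv 1 2 ⊛ qPochInfInv 4 8)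

{-# OPTIONS --safe #-}
-- Write q = t². For F(t) = Σ_{m,k ≥ 0} t^{2mk+m+k} / ((t²;t²)_m (t²;t²)_k), summing over k by Euler's
-- identity and then over m by the q-binomial theorem gives (t;t²)_∞ F = (t²;t²)_∞ / (t;t²)_∞, so
-- (t²;t⁴)_∞² F = (t²;t²)_∞ (-t;t²)_∞².  Squaring Euler's second identity and summing a Durfee-type
-- identity along diagonals shows that this product is 2 Σ_{n ≥ 0} t^{n²} - 1.  Now compare odd parts:
-- splitting m and k by parity, the odd part of F is 2t S(t²), with S(q) the left-hand side, while that of
-- 2 Σ_n t^{n²} is 2t Σ_n t^{4n(n+1)}.  Hence (q;q²)_∞² S(q) = Σ_n q^{2n(n+1)}, which Gauss's identity
-- turns into (q⁸;q⁸)_∞ / (q⁴;q⁸)_∞.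
--
-- Those of Euler type are
-- proved by showing that both sides, as functions of the parameter c in q^c, satisfy the same
-- q-difference equation X c = g c X (c + s) and agree modulo q^c, which determines them.

module Submission where

open import Data.Nat as N using (ℕ; zero; suc; _∸_; _≤_; _<_; z≤n; s≤s; _≡ᵇ_)
  renaming (_+_ to _+ℕ_; _*_ to _*ℕ_)
open import Data.Integer as Z using (ℤ; 0ℤ; 1ℤ; _+_; _*_; _-_; -_)
import Data.Nat.Properties as NP
import Data.Integer.Properties as ZP
open import Data.Integer.Tactic.RingSolver using (solve-∀)
open import Data.Nat.Tactic.RingSolver using () renaming (solve-∀ to solveℕ)
open import Data.Nat.Divisibility using (_∣?_; ∣m+n∣m⇒∣n; ∣m∣n⇒∣m+n; ∣-refl; _∣0; ∣⇒≤)
open import Data.Bool using (false; if_then_else_)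
open import Data.Maybe using (Maybe; just; nothing)
open import Data.Empty using (⊥-elim)
open import Data.Product using (_×_; _,_; proj₁; proj₂)
open import Level using (0ℓ)
open import Relation.Nullary using (Dec; yes; no; ¬_)
open import Relation.Binary.PropositionalEquality
open import Relation.Binary.Bundles using (Setoid)
open import Relation.Binary.Structures using (IsEquivalence)
open import Algebra.Bundles using (CommutativeRing; RawRing)
open import Algebra.Structures using (IsAbelianGroup; IsCommutativeRing)
import Algebra.Solver.Ring.AlmostCommutativeRing as ACR
import Algebra.Solver.Ring
import Relation.Binary.Reasoning.Setoid as SetoidReasoning
open import Defs

sumTo-cong : ∀ n {f g : ℕ → ℤ} → (∀ k → f k ≡ g k) → sumTo n f ≡ sumTo n g
sumTo-cong zero    e = refl
sumTo-cong (suc n) e = cong₂ _+_ (sumTo-cong n e) (e n)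

sumTo-cong< : ∀ n {f g : ℕ → ℤ} → (∀ k → k < n → f k ≡ g k) → sumTo n f ≡ sumTo n g
sumTo-cong< zero    e = refl
sumTo-cong< (suc n) e =
  cong₂ _+_ (sumTo-cong< n (λ k k<n → e k (NP.m<n⇒m<1+n k<n))) (e n NP.≤-refl)

sumTo-+ : ∀ n (f g : ℕ → ℤ) → sumTo n (λ k → f k + g k) ≡ sumTo n f + sumTo n g
sumTo-+ zero    f g = refl
sumTo-+ (suc n) f g rewrite sumTo-+ n f g = interchange (sumTo n f) (sumTo n g) (f n) (g n)
  where
  interchange : ∀ a b c d → (a + b) + (c + d) ≡ (a + c) + (b + d)
  interchange = solve-∀

sumTo-neg : ∀ n (f : ℕ → ℤ) → sumTo n (λ k → - f k) ≡ - sumTo n f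
sumTo-neg zero    f = refl
sumTo-neg (suc n) f rewrite sumTo-neg n f = sym (ZP.neg-distrib-+ (sumTo n f) (f n))

sumTo-*ˡ : ∀ n c (f : ℕ → ℤ) → sumTo n (λ k → c * f k) ≡ c * sumTo n f
sumTo-*ˡ zero    c f = sym (ZP.*-zeroʳ c)
sumTo-*ˡ (suc n) c f rewrite sumTo-*ˡ n c f = sym (ZP.*-distribˡ-+ c (sumTo n f) (f n))

sumTo-zero : ∀ n {f : ℕ → ℤ} → (∀ k → k < n → f k ≡ 0ℤ) → sumTo n f ≡ 0ℤ
sumTo-zero zero    z = refl
sumTo-zero (suc n) z
  rewrite sumTo-zero n (λ k k<n → z k (NP.m<n⇒m<1+n k<n)) | z n NP.≤-refl = refl

sumTo-front : ∀ n (f : ℕ → ℤ) → sumTo (suc n) f ≡ f 0 + sumTo n (λ k → f (suc k))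
sumTo-front zero    f = ZP.+-comm 0ℤ (f 0)
sumTo-front (suc n) f rewrite sumTo-front n f = ZP.+-assoc (f 0) _ _

sumTo-split : ∀ m n (f : ℕ → ℤ) → sumTo (m +ℕ n) f ≡ sumTo m f + sumTo n (λ k → f (m +ℕ k))
sumTo-split m zero    f rewrite NP.+-identityʳ m = sym (ZP.+-identityʳ _)
sumTo-split m (suc n) f rewrite NP.+-suc m n | sumTo-split m n f = ZP.+-assoc (sumTo m f) _ _

sumTo-pad : ∀ n m (f : ℕ → ℤ) → (∀ k → n ≤ k → f k ≡ 0ℤ) → n ≤ m → sumTo m f ≡ sumTo n f
sumTo-pad n m f z n≤m = begin
  sumTo m f
    ≡⟨ cong (λ x → sumTo x f) (sym (NP.m+[n∸m]≡n n≤m)) ⟩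
  sumTo (n +ℕ (m ∸ n)) f
    ≡⟨ sumTo-split n (m ∸ n) f ⟩
  sumTo n f + sumTo (m ∸ n) (λ k → f (n +ℕ k))
    ≡⟨ cong (sumTo n f +_) (sumTo-zero (m ∸ n) (λ k _ → z (n +ℕ k) (NP.m≤m+n n k))) ⟩
  sumTo n f + 0ℤ
    ≡⟨ ZP.+-identityʳ _ ⟩
  sumTo n f
    ∎
  where open ≡-Reasoning

sumTo-swap : ∀ n m (f : ℕ → ℕ → ℤ) →
  sumTo n (λ i → sumTo m (λ j → f i j)) ≡ sumTo m (λ j → sumTo n (λ i → f i j))
sumTo-swap zero    m f = sym (sumTo-zero m (λ _ _ → refl))
sumTo-swap (suc n) m f rewrite sumTo-swap n m f =
  sym (sumTo-+ m (λ j → sumTo n (λ i → f i j)) (λ j → f n j))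

sumTo-reverse : ∀ n (f : ℕ → ℤ) → sumTo (suc n) f ≡ sumTo (suc n) (λ k → f (n ∸ k))
sumTo-reverse zero    f = refl
sumTo-reverse (suc n) f = begin
  sumTo (suc n) f + f (suc n)                      ≡⟨ cong (_+ f (suc n)) (sumTo-reverse n f) ⟩
  sumTo (suc n) (λ k → f (n ∸ k)) + f (suc n)      ≡⟨ ZP.+-comm (sumTo (suc n) (λ k → f (n ∸ k))) (f (suc n)) ⟩
  f (suc n) + sumTo (suc n) (λ k → f (n ∸ k))      ≡⟨ sym (sumTo-front (suc n) (λ k → f (suc n ∸ k))) ⟩
  sumTo (suc (suc n)) (λ k → f (suc n ∸ k))        ∎
  where open ≡-Reasoning

sumTo-interleave : ∀ m (f : ℕ → ℤ) →
  sumTo (m +ℕ m) f ≡ sumTo m (λ k → f (k +ℕ k)) + sumTo m (λ k → f (suc (k +ℕ k)))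
sumTo-interleave zero    f = refl
sumTo-interleave (suc m) f rewrite NP.+-suc m m | sumTo-interleave m f =
  regroup (sumTo m (λ k → f (k +ℕ k))) (sumTo m (λ k → f (suc (k +ℕ k)))) (f (m +ℕ m)) (f (suc (m +ℕ m)))
  where
  regroup : ∀ a b c d → a + b + c + d ≡ a + c + (b + d)
  regroup = solve-∀

-- The ring of formal power series

infix 4 _≈_
record _≈_ (f g : PS) : Set where
  constructor mk≈
  field at : ∀ n → f n ≡ g n
open _≈_ public

infixl 6 _⊕_ _⊝_
_⊕_ : PS → PS → PS
(f ⊕ g) n = f n + g n

_⊝_ : PS → PS → PS
(f ⊝ g) n = f n - g n

⊖_ : PS → PS
(⊖ f) n = - f n

𝟘 : PS
𝟘 n = 0ℤ

infixl 7 _·_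
_·_ : ℤ → PS → PS
(c · f) n = c * f n

tail : PS → PS
tail f n = f (suc n)

≈-refl : ∀ {f} → f ≈ f
≈-refl = mk≈ (λ n → refl)

≈-sym : ∀ {f g} → f ≈ g → g ≈ f
≈-sym e = mk≈ (λ n → sym (at e n))

≈-trans : ∀ {f g h} → f ≈ g → g ≈ h → f ≈ h
≈-trans e e' = mk≈ (λ n → trans (at e n) (at e' n))

≈-reflexive : ∀ {f g} → f ≡ g → f ≈ g
≈-reflexive refl = ≈-refl

PS-isEquivalence : IsEquivalence _≈_
PS-isEquivalence = record { refl = ≈-refl ; sym = ≈-sym ; trans = ≈-trans }

PS-setoid : Setoid 0ℓ 0ℓ
PS-setoid = record { isEquivalence = PS-isEquivalence }

module ≈-Reasoning = SetoidReasoning PS-setoid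

⊕-cong : ∀ {f f' g g'} → f ≈ f' → g ≈ g' → f ⊕ g ≈ f' ⊕ g'
⊕-cong e e' = mk≈ (λ n → cong₂ _+_ (at e n) (at e' n))

⊖-cong : ∀ {f g} → f ≈ g → ⊖ f ≈ ⊖ g
⊖-cong e = mk≈ (λ n → cong -_ (at e n))

⊛-cong : ∀ {f f' g g'} → f ≈ f' → g ≈ g' → f ⊛ g ≈ f' ⊛ g'
⊛-cong e e' = mk≈ (λ n → sumTo-cong (suc n) (λ k → cong₂ _*_ (at e k) (at e' (n ∸ k))))

⊛-congˡ : ∀ {f f'} → f ≈ f' → ∀ g → f ⊛ g ≈ f' ⊛ g
⊛-congˡ e g = ⊛-cong e (≈-refl {g})

⊛-congʳ : ∀ f {g g'} → g ≈ g' → f ⊛ g ≈ f ⊛ g'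
⊛-congʳ f e = ⊛-cong (≈-refl {f}) e

⊛-zero-at : ∀ (f g : PS) → (f ⊛ g) 0 ≡ f 0 * g 0
⊛-zero-at f g = ZP.+-identityˡ _

⊛-suc-at : ∀ (f g : PS) n → (f ⊛ g) (suc n) ≡ f 0 * g (suc n) + (tail f ⊛ g) n
⊛-suc-at f g n = sumTo-front (suc n) (λ k → f k * g (suc n ∸ k))

⊛-comm : ∀ f g → f ⊛ g ≈ g ⊛ f
⊛-comm f g = mk≈ λ n → begin
  sumTo (suc n) (λ k → f k * g (n ∸ k))                 ≡⟨ sumTo-reverse n _ ⟩
  sumTo (suc n) (λ k → f (n ∸ k) * g (n ∸ (n ∸ k)))     ≡⟨ sumTo-cong< (suc n) (λ k k<n → swap n k (NP.≤-pred k<n)) ⟩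
  sumTo (suc n) (λ k → g k * f (n ∸ k))                 ∎
  where
  open ≡-Reasoning
  swap : ∀ n k → k ≤ n → f (n ∸ k) * g (n ∸ (n ∸ k)) ≡ g k * f (n ∸ k)
  swap n k k≤n rewrite NP.m∸[m∸n]≡n k≤n = ZP.*-comm (f (n ∸ k)) (g k)

⊛-distribʳ-at : ∀ f g h n → ((f ⊕ g) ⊛ h) n ≡ (f ⊛ h) n + (g ⊛ h) n
⊛-distribʳ-at f g h n =
  trans (sumTo-cong (suc n) (λ k → ZP.*-distribʳ-+ (h (n ∸ k)) (f k) (g k))) (sumTo-+ (suc n) _ _)

⊛-distribʳ : ∀ f g h → (f ⊕ g) ⊛ h ≈ f ⊛ h ⊕ g ⊛ h
⊛-distribʳ f g h = mk≈ (⊛-distribʳ-at f g h)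

⊛-distribˡ : ∀ f g h → h ⊛ (f ⊕ g) ≈ h ⊛ f ⊕ h ⊛ g
⊛-distribˡ f g h = mk≈ λ n →
  trans (sumTo-cong (suc n) (λ k → ZP.*-distribˡ-+ (h k) (f (n ∸ k)) (g (n ∸ k)))) (sumTo-+ (suc n) _ _)

·-⊛-at : ∀ c f g n → ((c · f) ⊛ g) n ≡ c * (f ⊛ g) n
·-⊛-at c f g n = trans (sumTo-cong (suc n) (λ k → ZP.*-assoc c (f k) (g (n ∸ k)))) (sumTo-*ˡ (suc n) c _)

⊛-assoc-at : ∀ f g h n → ((f ⊛ g) ⊛ h) n ≡ (f ⊛ (g ⊛ h)) n
⊛-assoc-at f g h zero = assoc₀ (f 0) (g 0) (h 0)
  where
  assoc₀ : ∀ a b c → 0ℤ + (0ℤ + a * b) * c ≡ 0ℤ + a * (0ℤ + b * c)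
  assoc₀ = solve-∀
⊛-assoc-at f g h (suc n) = begin
  ((f ⊛ g) ⊛ h) (suc n)
    ≡⟨ ⊛-suc-at (f ⊛ g) h n ⟩
  (f ⊛ g) 0 * h (suc n) + (tail (f ⊛ g) ⊛ h) n
    ≡⟨ cong₂ (λ x y → x * h (suc n) + y) (⊛-zero-at f g) (at (⊛-congˡ (mk≈ (⊛-suc-at f g)) h) n) ⟩
  f 0 * g 0 * h (suc n) + ((f 0 · tail g ⊕ tail f ⊛ g) ⊛ h) n
    ≡⟨ cong (f 0 * g 0 * h (suc n) +_) (⊛-distribʳ-at (f 0 · tail g) (tail f ⊛ g) h n) ⟩
  f 0 * g 0 * h (suc n) + (((f 0 · tail g) ⊛ h) n + ((tail f ⊛ g) ⊛ h) n)
    ≡⟨ cong₂ (λ x y → f 0 * g 0 * h (suc n) + (x + y)) (·-⊛-at (f 0) (tail g) h n) (⊛-assoc-at (tail f) g h n) ⟩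
  f 0 * g 0 * h (suc n) + (f 0 * (tail g ⊛ h) n + (tail f ⊛ (g ⊛ h)) n)
    ≡⟨ factor (f 0) (g 0) (h (suc n)) ((tail g ⊛ h) n) ((tail f ⊛ (g ⊛ h)) n) ⟩
  f 0 * (g 0 * h (suc n) + (tail g ⊛ h) n) + (tail f ⊛ (g ⊛ h)) n
    ≡⟨ cong (λ x → f 0 * x + (tail f ⊛ (g ⊛ h)) n) (sym (⊛-suc-at g h n)) ⟩
  f 0 * (g ⊛ h) (suc n) + (tail f ⊛ (g ⊛ h)) n
    ≡⟨ sym (⊛-suc-at f (g ⊛ h) n) ⟩
  (f ⊛ (g ⊛ h)) (suc n)
    ∎
  where
  open ≡-Reasoning
  factor : ∀ a b c x y → a * b * c + (a * x + y) ≡ a * (b * c + x) + y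
  factor = solve-∀

⊛-assoc : ∀ f g h → (f ⊛ g) ⊛ h ≈ f ⊛ (g ⊛ h)
⊛-assoc f g h = mk≈ (⊛-assoc-at f g h)

𝟙-⊛-at : ∀ f n → (𝟙 ⊛ f) n ≡ f n
𝟙-⊛-at f n = begin
  (𝟙 ⊛ f) n
    ≡⟨ sumTo-front n (λ k → 𝟙 k * f (n ∸ k)) ⟩
  1ℤ * f n + sumTo n (λ k → 0ℤ * f (n ∸ suc k))
    ≡⟨ cong₂ _+_ (ZP.*-identityˡ (f n)) (sumTo-zero n (λ k _ → ZP.*-zeroˡ (f (n ∸ suc k)))) ⟩
  f n + 0ℤ
    ≡⟨ ZP.+-identityʳ (f n) ⟩
  f n
    ∎
  where open ≡-Reasoning

𝟙-⊛ : ∀ f → 𝟙 ⊛ f ≈ f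
𝟙-⊛ f = mk≈ (𝟙-⊛-at f)

⊛-𝟙 : ∀ f → f ⊛ 𝟙 ≈ f
⊛-𝟙 f = ≈-trans (⊛-comm f 𝟙) (𝟙-⊛ f)

⊛-𝟘 : ∀ f → f ⊛ 𝟘 ≈ 𝟘
⊛-𝟘 f = mk≈ (λ n → sumTo-zero (suc n) (λ k _ → ZP.*-zeroʳ (f k)))

𝟘-⊛ : ∀ f → 𝟘 ⊛ f ≈ 𝟘
𝟘-⊛ f = ≈-trans (⊛-comm 𝟘 f) (⊛-𝟘 f)

PS-+-isAbelianGroup : IsAbelianGroup _≈_ _⊕_ 𝟘 ⊖_
PS-+-isAbelianGroup = record
  { isGroup = record
    { isMonoid = record
      { isSemigroup = record
        { isMagma = record { isEquivalence = PS-isEquivalence ; ∙-cong = ⊕-cong }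
        ; assoc = λ f g h → mk≈ (λ n → ZP.+-assoc (f n) (g n) (h n)) }
      ; identity = (λ f → mk≈ (λ n → ZP.+-identityˡ (f n))) , (λ f → mk≈ (λ n → ZP.+-identityʳ (f n))) }
    ; inverse = (λ f → mk≈ (λ n → ZP.+-inverseˡ (f n))) , (λ f → mk≈ (λ n → ZP.+-inverseʳ (f n)))
    ; ⁻¹-cong = ⊖-cong }
  ; comm = λ f g → mk≈ (λ n → ZP.+-comm (f n) (g n)) }

PS-isCommutativeRing : IsCommutativeRing _≈_ _⊕_ _⊛_ ⊖_ 𝟘 𝟙
PS-isCommutativeRing = record
  { isRing = record
    { +-isAbelianGroup = PS-+-isAbelianGroup
    ; *-cong = ⊛-cong
    ; *-assoc = ⊛-assoc
    ; *-identity = 𝟙-⊛ , ⊛-𝟙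
    ; distrib = (λ x y z → ⊛-distribˡ y z x) , (λ x y z → ⊛-distribʳ y z x) }
  ; *-comm = ⊛-comm }

PS-commutativeRing : CommutativeRing 0ℓ 0ℓ
PS-commutativeRing = record { isCommutativeRing = PS-isCommutativeRing }

-- 0 and 1 go to 𝟘 and 𝟙 themselves, so that solver terms such as con 1ℤ :- m are definitionally 𝟙 ⊝ m.
const : ℤ → PS
const (Z.+ 0) = 𝟘
const (Z.+ 1) = 𝟙
const c       = c · 𝟙

const≈·𝟙 : ∀ c → const c ≈ c · 𝟙
const≈·𝟙 (Z.+ 0)             = mk≈ (λ n → sym (ZP.*-zeroˡ (𝟙 n)))
const≈·𝟙 (Z.+ 1)             = mk≈ (λ n → sym (ZP.*-identityˡ (𝟙 n)))
const≈·𝟙 (Z.+ suc (suc k))   = ≈-refl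
const≈·𝟙 (Z.-[1+ k ])        = ≈-refl

ℤ-rawRing : RawRing 0ℓ 0ℓ
ℤ-rawRing = CommutativeRing.rawRing ZP.+-*-commutativeRing

PS-almostCommutativeRing : ACR.AlmostCommutativeRing 0ℓ 0ℓ
PS-almostCommutativeRing = ACR.fromCommutativeRing PS-commutativeRing

const-homomorphism : ℤ-rawRing ACR.-Raw-AlmostCommutative⟶ PS-almostCommutativeRing
const-homomorphism = record
  { ⟦_⟧    = const
  ; +-homo = λ a b → ≈-trans (const≈·𝟙 (a + b))
               (≈-trans (mk≈ (λ n → ZP.*-distribʳ-+ (𝟙 n) a b)) (⊕-cong (≈-sym (const≈·𝟙 a)) (≈-sym (const≈·𝟙 b))))
  ; *-homo = λ a b → ≈-trans (const≈·𝟙 (a * b))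
               (≈-trans (mk≈ (·𝟙-⊛-·𝟙 a b)) (⊛-cong (≈-sym (const≈·𝟙 a)) (≈-sym (const≈·𝟙 b))))
  ; -‿homo = λ a → ≈-trans (const≈·𝟙 (- a))
               (mk≈ (λ n → trans (sym (ZP.neg-distribˡ-* a (𝟙 n))) (cong -_ (sym (at (const≈·𝟙 a) n)))))
  ; 0-homo = ≈-refl
  ; 1-homo = ≈-refl }
  where
  ·𝟙-⊛-·𝟙 : ∀ a b n → (a * b) * 𝟙 n ≡ ((a · 𝟙) ⊛ (b · 𝟙)) n
  ·𝟙-⊛-·𝟙 a b n =
    sym (trans (·-⊛-at a 𝟙 (b · 𝟙) n) (trans (cong (a *_) (𝟙-⊛-at (b · 𝟙) n)) (sym (ZP.*-assoc a b (𝟙 n)))))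

const-equal? : ∀ a b → Maybe (const a ≈ const b)
const-equal? a b with a ZP.≟ b
... | yes refl = just ≈-refl
... | no _     = nothing

module PS-Solver = Algebra.Solver.Ring ℤ-rawRing PS-almostCommutativeRing const-homomorphism const-equal?
open PS-Solver using (solve; _:+_; _:*_; _:-_; _:=_; con)

-- Orders and truncated equality

O : ℕ → PS → Set
O k f = ∀ n → n < k → f n ≡ 0ℤ

infix 4 _≡[_]_
_≡[_]_ : PS → ℕ → PS → Set
f ≡[ N ] g = ∀ n → n < N → f n ≡ g n

≈⇒≡[] : ∀ {f g} N → f ≈ g → f ≡[ N ] g
≈⇒≡[] N e n _ = at e n

≡[]-trans : ∀ {f g h N} → f ≡[ N ] g → g ≡[ N ] h → f ≡[ N ] h
≡[]-trans e e' n p = trans (e n p) (e' n p)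

≡[]-sym : ∀ {f g N} → f ≡[ N ] g → g ≡[ N ] f
≡[]-sym e n p = sym (e n p)

≡[]-weaken : ∀ {f g N M} → M ≤ N → f ≡[ N ] g → f ≡[ M ] g
≡[]-weaken M≤N e n p = e n (NP.<-≤-trans p M≤N)

≡[]⇒O : ∀ {f g N} → f ≡[ N ] g → O N (f ⊝ g)
≡[]⇒O e n p = ZP.i≡j⇒i-j≡0 (e n p)

O⇒≡[] : ∀ {f g N} → O N (f ⊝ g) → f ≡[ N ] g
O⇒≡[] {f} {g} o n p = ZP.i-j≡0⇒i≡j (f n) (g n) (o n p)

O-weaken : ∀ {f N M} → M ≤ N → O N f → O M f
O-weaken M≤N o n p = o n (NP.<-≤-trans p M≤N)

O-resp-≈ : ∀ {f g N} → f ≈ g → O N f → O N g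
O-resp-≈ e o n p = trans (sym (at e n)) (o n p)

O-⊝ : ∀ k f g → O k f → O k g → O k (f ⊝ g)
O-⊝ k f g of og n p rewrite of n p | og n p = refl

O-⊛ : ∀ a b f g → O a f → O b g → O (a +ℕ b) (f ⊛ g)
O-⊛ a b f g oa ob n n<a+b = sumTo-zero (suc n) term
  where
  term : ∀ k → k < suc n → f k * g (n ∸ k) ≡ 0ℤ
  term k k<1+n with k N.<? a
  ... | yes k<a rewrite oa k k<a = refl
  ... | no k≮a = trans (cong (f k *_) (ob (n ∸ k) n∸k<b)) (ZP.*-zeroʳ (f k))
    where
    n∸k<b : n ∸ k < b
    n∸k<b = NP.+-cancelˡ-< k (n ∸ k) b
      (subst (_< k +ℕ b) (sym (NP.m+[n∸m]≡n (NP.≤-pred k<1+n)))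
        (NP.<-≤-trans n<a+b (NP.+-monoˡ-≤ b (NP.≮⇒≥ k≮a))))

O-⊛ˡ : ∀ a f g → O a f → O a (f ⊛ g)
O-⊛ˡ a f g oa = subst (λ x → O x (f ⊛ g)) (NP.+-identityʳ a) (O-⊛ a 0 f g oa (λ n ()))

O-⊛ʳ : ∀ b f g → O b g → O b (f ⊛ g)
O-⊛ʳ b f g ob = O-⊛ 0 b f g (λ n ()) ob

≡[]-⊛ : ∀ {f f' g g'} N → f ≡[ N ] f' → g ≡[ N ] g' → f ⊛ g ≡[ N ] f' ⊛ g'
≡[]-⊛ N e e' n n<N = sumTo-cong< (suc n) (λ k k<1+n →
  cong₂ _*_ (e k (NP.≤-<-trans (NP.≤-pred k<1+n) n<N)) (e' (n ∸ k) (NP.≤-<-trans (NP.m∸n≤m n k) n<N)))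

≡[]-⊛-𝟙 : ∀ {f g} N → f ≡[ N ] 𝟙 → g ≡[ N ] 𝟙 → f ⊛ g ≡[ N ] 𝟙
≡[]-⊛-𝟙 N e e' = ≡[]-trans (≡[]-⊛ N e e') (≈⇒≡[] N (𝟙-⊛ 𝟙))

≡[]-⊛𝟙 : ∀ f {g} N → g ≡[ N ] 𝟙 → f ⊛ g ≡[ N ] f
≡[]-⊛𝟙 f N e = ≡[]-trans (≡[]-⊛ {f} {f} N (λ _ _ → refl) e) (≈⇒≡[] N (⊛-𝟙 f))

mono-≡ : ∀ {a b} → a ≡ b → mono a ≈ mono b
mono-≡ refl = ≈-refl

mono-< : ∀ c n → n < c → mono c n ≡ 0ℤ
mono-< (suc c) zero    _       = refl
mono-< (suc c) (suc n) (s≤s p) = mono-< c n p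

mono-zero : mono 0 ≈ 𝟙
mono-zero = mk≈ λ { zero → refl ; (suc n) → refl }

mono-suc-⊛-at : ∀ m f n → (mono (suc m) ⊛ f) (suc n) ≡ (mono m ⊛ f) n
mono-suc-⊛-at m f n = trans (⊛-suc-at (mono (suc m)) f n) (ZP.+-identityˡ _)

O-mono : ∀ m → O m (mono m)
O-mono = mono-<

O-mono-⊛ : ∀ m f → O m (mono m ⊛ f)
O-mono-⊛ (suc m) f zero    _       = refl
O-mono-⊛ (suc m) f (suc n) (s≤s p) = trans (mono-suc-⊛-at m f n) (O-mono-⊛ m f n p)

O-mono-⊛-≤ : ∀ {i e} f → i ≤ e → O i (mono e ⊛ f)
O-mono-⊛-≤ {i} {e} f i≤e = O-weaken i≤e (O-mono-⊛ e f)

mono-⊛-at : ∀ m f n → (mono m ⊛ f) (m +ℕ n) ≡ f n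
mono-⊛-at zero    f n = trans (at (⊛-congˡ mono-zero f) n) (𝟙-⊛-at f n)
mono-⊛-at (suc m) f n = trans (mono-suc-⊛-at m f (m +ℕ n)) (mono-⊛-at m f n)

mono-+ : ∀ a b → mono a ⊛ mono b ≈ mono (a +ℕ b)
mono-+ zero    b = ≈-trans (⊛-congˡ mono-zero (mono b)) (𝟙-⊛ (mono b))
mono-+ (suc a) b = mk≈ coeff
  where
  coeff : ∀ n → (mono (suc a) ⊛ mono b) n ≡ mono (suc a +ℕ b) n
  coeff zero    = refl
  coeff (suc n) = trans (mono-suc-⊛-at a (mono b) n) (at (mono-+ a b) n)

mono-split : ∀ a b c → a ≡ b +ℕ c → mono a ≈ mono b ⊛ mono c
mono-split a b c e = ≈-trans (mono-≡ e) (≈-sym (mono-+ b c))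

onePlus : ℕ → PS
onePlus c = 𝟙 ⊕ mono c

oneMinus-≡ : ∀ {a b} → a ≡ b → oneMinus a ≈ oneMinus b
oneMinus-≡ refl = ≈-refl

inv1m-≡ : ∀ {a b} → a ≡ b → inv1m a ≈ inv1m b
inv1m-≡ refl = ≈-refl

oneMinus-zero : oneMinus 0 ≈ 𝟘
oneMinus-zero = mk≈ (λ n → trans (cong (λ x → 𝟙 n - x) (at mono-zero n)) (ZP.+-inverseʳ (𝟙 n)))

oneMinus≡[]𝟙 : ∀ c → oneMinus c ≡[ c ] 𝟙
oneMinus≡[]𝟙 c n p rewrite mono-< c n p = ZP.+-identityʳ (𝟙 n)

onePlus≡[]𝟙 : ∀ c → onePlus c ≡[ c ] 𝟙
onePlus≡[]𝟙 c n p rewrite mono-< c n p = ZP.+-identityʳ (𝟙 n)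

inv1m≡[]𝟙 : ∀ c → 1 ≤ c → inv1m c ≡[ c ] 𝟙
inv1m≡[]𝟙 c c≥1 zero _ with c ∣? 0
... | yes _  = refl
... | no c∤0 = ⊥-elim (c∤0 (c ∣0))
inv1m≡[]𝟙 c c≥1 (suc n) p with c ∣? suc n
... | yes c∣1+n = ⊥-elim (NP.<⇒≱ p (∣⇒≤ c∣1+n))
... | no _      = refl

inv1m-periodic : ∀ c m → inv1m c (c +ℕ m) ≡ inv1m c m
inv1m-periodic c m with c ∣? (c +ℕ m) | c ∣? m
... | yes _ | yes _ = refl
... | yes p | no q  = ⊥-elim (q (∣m+n∣m⇒∣n p ∣-refl))
... | no p  | yes q = ⊥-elim (p (∣m∣n⇒∣m+n ∣-refl q))
... | no _  | no _  = refl

𝟙-≥ : ∀ c m → 1 ≤ c → 𝟙 (c +ℕ m) ≡ 0ℤ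
𝟙-≥ (suc c) m _ = refl

inv1m-⊛-oneMinus : ∀ c → 1 ≤ c → inv1m c ⊛ oneMinus c ≈ 𝟙
inv1m-⊛-oneMinus c c≥1 = ≈-trans expand (mk≈ coeff)
  where
  expand : inv1m c ⊛ oneMinus c ≈ inv1m c ⊝ mono c ⊛ inv1m c
  expand = solve 2 (λ i m → i :* (con 1ℤ :- m) := i :- m :* i) ≈-refl (inv1m c) (mono c)
  coeff : ∀ n → inv1m c n - (mono c ⊛ inv1m c) n ≡ 𝟙 n
  coeff n with n N.<? c
  ... | yes n<c rewrite O-mono-⊛ c (inv1m c) n n<c = trans (ZP.+-identityʳ _) (inv1m≡[]𝟙 c c≥1 n n<c)
  ... | no n≮c = begin
    inv1m c n - (mono c ⊛ inv1m c) n
      ≡⟨ cong (λ x → inv1m c x - (mono c ⊛ inv1m c) x) (sym c+[n∸c]≡n) ⟩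
    inv1m c (c +ℕ (n ∸ c)) - (mono c ⊛ inv1m c) (c +ℕ (n ∸ c))
      ≡⟨ cong₂ _-_ (inv1m-periodic c (n ∸ c)) (mono-⊛-at c (inv1m c) (n ∸ c)) ⟩
    inv1m c (n ∸ c) - inv1m c (n ∸ c)
      ≡⟨ ZP.+-inverseʳ (inv1m c (n ∸ c)) ⟩
    0ℤ
      ≡⟨ sym (𝟙-≥ c (n ∸ c) c≥1) ⟩
    𝟙 (c +ℕ (n ∸ c))
      ≡⟨ cong 𝟙 c+[n∸c]≡n ⟩
    𝟙 n
      ∎
    where
    open ≡-Reasoning
    c+[n∸c]≡n : c +ℕ (n ∸ c) ≡ n
    c+[n∸c]≡n = NP.m+[n∸m]≡n (NP.≮⇒≥ n≮c)

oneMinus-⊛-inv1m : ∀ c → 1 ≤ c → oneMinus c ⊛ inv1m c ≈ 𝟙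
oneMinus-⊛-inv1m c c≥1 = ≈-trans (⊛-comm (oneMinus c) (inv1m c)) (inv1m-⊛-oneMinus c c≥1)

oneMinus-⊛-onePlus : ∀ c → oneMinus c ⊛ onePlus c ≈ oneMinus (c +ℕ c)
oneMinus-⊛-onePlus c =
  ≈-trans (solve 1 (λ m → (con 1ℤ :- m) :* (con 1ℤ :+ m) := con 1ℤ :- m :* m) ≈-refl (mono c))
          (⊕-cong (≈-refl {𝟙}) (⊖-cong (mono-+ c c)))

inverse-unique : ∀ x y o → x ⊛ o ≈ 𝟙 → y ⊛ o ≈ 𝟙 → x ≈ y
inverse-unique x y o x⊛o≈𝟙 y⊛o≈𝟙 = begin
  x              ≈⟨ ≈-sym (⊛-𝟙 x) ⟩
  x ⊛ 𝟙          ≈⟨ ⊛-congʳ x (≈-trans (≈-sym y⊛o≈𝟙) (⊛-comm y o)) ⟩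
  x ⊛ (o ⊛ y)    ≈⟨ ≈-sym (⊛-assoc x o y) ⟩
  (x ⊛ o) ⊛ y    ≈⟨ ⊛-congˡ x⊛o≈𝟙 y ⟩
  𝟙 ⊛ y          ≈⟨ 𝟙-⊛ y ⟩
  y              ∎
  where open ≈-Reasoning

oneMinus-⊛⇒inv1m : ∀ c X Y → 1 ≤ c → oneMinus c ⊛ X ≈ Y → X ≈ inv1m c ⊛ Y
oneMinus-⊛⇒inv1m c X Y c≥1 e = begin
  X                               ≈⟨ ≈-sym (𝟙-⊛ X) ⟩
  𝟙 ⊛ X                           ≈⟨ ⊛-congˡ (≈-sym (inv1m-⊛-oneMinus c c≥1)) X ⟩
  (inv1m c ⊛ oneMinus c) ⊛ X      ≈⟨ ⊛-assoc (inv1m c) (oneMinus c) X ⟩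
  inv1m c ⊛ (oneMinus c ⊛ X)      ≈⟨ ⊛-congʳ (inv1m c) e ⟩
  inv1m c ⊛ Y                     ∎
  where open ≈-Reasoning

-- Finite and infinite products

prodTo-cong : ∀ m {F G : ℕ → PS} → (∀ k → k < m → F k ≈ G k) → prodTo m F ≈ prodTo m G
prodTo-cong zero    e = ≈-refl
prodTo-cong (suc m) e = ⊛-cong (prodTo-cong m (λ k p → e k (NP.m<n⇒m<1+n p))) (e m NP.≤-refl)

prodTo-⊛ : ∀ m (F G : ℕ → PS) → prodTo m (λ k → F k ⊛ G k) ≈ prodTo m F ⊛ prodTo m G
prodTo-⊛ zero    F G = ≈-sym (𝟙-⊛ 𝟙)
prodTo-⊛ (suc m) F G =
  ≈-trans (⊛-congˡ (prodTo-⊛ m F G) (F m ⊛ G m)) (interchange (prodTo m F) (prodTo m G) (F m) (G m))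
  where
  interchange : ∀ a b c d → (a ⊛ b) ⊛ (c ⊛ d) ≈ (a ⊛ c) ⊛ (b ⊛ d)
  interchange = solve 4 (λ a b c d → (a :* b) :* (c :* d) := (a :* c) :* (b :* d)) ≈-refl

prodTo-split : ∀ a b (F : ℕ → PS) → prodTo (a +ℕ b) F ≈ prodTo a F ⊛ prodTo b (λ k → F (a +ℕ k))
prodTo-split a zero    F rewrite NP.+-identityʳ a = ≈-sym (⊛-𝟙 (prodTo a F))
prodTo-split a (suc b) F rewrite NP.+-suc a b =
  ≈-trans (⊛-congˡ (prodTo-split a b F) (F (a +ℕ b))) (⊛-assoc (prodTo a F) (prodTo b (λ k → F (a +ℕ k))) (F (a +ℕ b)))

prodTo-𝟙 : ∀ m (F : ℕ → PS) → (∀ k → F k ≈ 𝟙) → prodTo m F ≈ 𝟙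
prodTo-𝟙 zero    F e = ≈-refl
prodTo-𝟙 (suc m) F e = ≈-trans (⊛-cong (prodTo-𝟙 m F e) (e m)) (𝟙-⊛ 𝟙)

prodTo-interleave : ∀ m (F : ℕ → PS) →
  prodTo (m +ℕ m) F ≈ prodTo m (λ k → F (k +ℕ k)) ⊛ prodTo m (λ k → F (suc (k +ℕ k)))
prodTo-interleave zero    F = ≈-sym (𝟙-⊛ 𝟙)
prodTo-interleave (suc m) F rewrite NP.+-suc m m =
  ≈-trans (⊛-congˡ (⊛-congˡ (prodTo-interleave m F) (F (m +ℕ m))) (F (suc (m +ℕ m))))
          (regroup (prodTo m (λ k → F (k +ℕ k))) (prodTo m (λ k → F (suc (k +ℕ k)))) (F (m +ℕ m)) (F (suc (m +ℕ m))))
  where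
  regroup : ∀ a b c d → ((a ⊛ b) ⊛ c) ⊛ d ≈ (a ⊛ c) ⊛ (b ⊛ d)
  regroup = solve 4 (λ a b c d → ((a :* b) :* c) :* d := (a :* c) :* (b :* d)) ≈-refl

prodTo≡[]𝟙 : ∀ m N (F : ℕ → PS) → (∀ k → k < m → F k ≡[ N ] 𝟙) → prodTo m F ≡[ N ] 𝟙
prodTo≡[]𝟙 zero    N F e n _ = refl
prodTo≡[]𝟙 (suc m) N F e = ≡[]-⊛-𝟙 N (prodTo≡[]𝟙 m N F (λ k p → e k (NP.m<n⇒m<1+n p))) (e m NP.≤-refl)

ProdConvergent : (ℕ → PS) → Set
ProdConvergent F = ∀ k → F k ≡[ suc k ] 𝟙

ProdConvergent-shift : ∀ {F} m → ProdConvergent F → ProdConvergent (λ k → F (m +ℕ k))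
ProdConvergent-shift {F} m cv k = ≡[]-weaken (s≤s (NP.m≤n+m k m)) (cv (m +ℕ k))

ProdConvergent-even : ∀ {F} → ProdConvergent F → ProdConvergent (λ k → F (k +ℕ k))
ProdConvergent-even {F} cv k = ≡[]-weaken (s≤s (NP.m≤m+n k k)) (cv (k +ℕ k))

ProdConvergent-odd : ∀ {F} → ProdConvergent F → ProdConvergent (λ k → F (suc (k +ℕ k)))
ProdConvergent-odd {F} cv k = ≡[]-weaken (s≤s (NP.m≤n⇒m≤1+n (NP.m≤m+n k k))) (cv (suc (k +ℕ k)))

prodTo-stable : ∀ {F} → ProdConvergent F → ∀ M d → prodTo (M +ℕ d) F ≡[ M ] prodTo M F
prodTo-stable {F} cv M d =
  ≡[]-trans (≈⇒≡[] M (prodTo-split M d F))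
    (≡[]-⊛𝟙 (prodTo M F) M (prodTo≡[]𝟙 d M (λ k → F (M +ℕ k))
       (λ k _ → ≡[]-weaken (NP.m≤n⇒m≤1+n (NP.m≤m+n M k)) (cv (M +ℕ k)))))

infProd≡[]prodTo : ∀ {F} → ProdConvergent F → ∀ M → infProd F ≡[ M ] prodTo M F
infProd≡[]prodTo {F} cv M n n<M =
  sym (trans (cong (λ x → prodTo x F n) (sym (NP.m+[n∸m]≡n n<M))) (prodTo-stable cv (suc n) (M ∸ suc n) n NP.≤-refl))

infProd-cong : ∀ {F G} → (∀ k → F k ≈ G k) → infProd F ≈ infProd G
infProd-cong e = mk≈ (λ n → at (prodTo-cong (suc n) (λ k _ → e k)) n)

infProd-𝟙 : ∀ {F} → (∀ k → F k ≈ 𝟙) → infProd F ≈ 𝟙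
infProd-𝟙 {F} e = mk≈ (λ n → at (prodTo-𝟙 (suc n) F e) n)

infProd≡[]𝟙 : ∀ {F} N → (∀ k → F k ≡[ N ] 𝟙) → infProd F ≡[ N ] 𝟙
infProd≡[]𝟙 {F} N e n p = prodTo≡[]𝟙 (suc n) N F (λ k _ → e k) n p

infProd-⊛ : ∀ {F G} → ProdConvergent F → ProdConvergent G →
  infProd (λ k → F k ⊛ G k) ≈ infProd F ⊛ infProd G
infProd-⊛ {F} {G} cvF cvG = mk≈ λ n →
  trans (at (prodTo-⊛ (suc n) F G) n)
        (sym (≡[]-⊛ (suc n) (infProd≡[]prodTo cvF (suc n)) (infProd≡[]prodTo cvG (suc n)) n NP.≤-refl))

infProd-split : ∀ {F} → ProdConvergent F → ∀ m → infProd F ≈ prodTo m F ⊛ infProd (λ k → F (m +ℕ k))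
infProd-split {F} cv m = mk≈ λ n →
  trans (infProd≡[]prodTo cv (m +ℕ suc n) n (NP.≤-trans (NP.n<1+n n) (NP.m≤n+m (suc n) m)))
   (trans (at (prodTo-split m (suc n) F) n)
    (sym (≡[]-⊛ {prodTo m F} {prodTo m F} (suc n) (λ _ _ → refl)
                (infProd≡[]prodTo (ProdConvergent-shift m cv) (suc n)) n NP.≤-refl)))

infProd-interleave : ∀ {F} → ProdConvergent F →
  infProd F ≈ infProd (λ k → F (k +ℕ k)) ⊛ infProd (λ k → F (suc (k +ℕ k)))
infProd-interleave {F} cv = mk≈ λ n →
  trans (infProd≡[]prodTo cv (suc n +ℕ suc n) n (NP.≤-trans (NP.n<1+n n) (NP.m≤m+n (suc n) (suc n))))
   (trans (at (prodTo-interleave (suc n) F) n)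
    (sym (≡[]-⊛ (suc n) (infProd≡[]prodTo (ProdConvergent-even cv) (suc n))
                        (infProd≡[]prodTo (ProdConvergent-odd cv) (suc n)) n NP.≤-refl)))

prodAP : (ℕ → PS) → ℕ → ℕ → PS
prodAP G c s = infProd (λ k → G (c +ℕ s *ℕ k))

ProdConvergent-AP : ∀ (G : ℕ → PS) → (∀ c → 1 ≤ c → G c ≡[ c ] 𝟙) →
  ∀ a d → 1 ≤ a → 1 ≤ d → ProdConvergent (λ k → G (a +ℕ d *ℕ k))
ProdConvergent-AP G G≡[]𝟙 a d a≥1 d≥1 k = ≡[]-weaken 1+k≤ (G≡[]𝟙 (a +ℕ d *ℕ k) (NP.≤-trans (s≤s z≤n) 1+k≤))
  where
  1+k≤ : suc k ≤ a +ℕ d *ℕ k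
  1+k≤ = NP.+-mono-≤ a≥1 (NP.≤-trans (NP.≤-reflexive (sym (NP.*-identityˡ k))) (NP.*-monoˡ-≤ k d≥1))

ProdConvergent-oneMinus : ∀ a d → 1 ≤ a → 1 ≤ d → ProdConvergent (λ k → oneMinus (a +ℕ d *ℕ k))
ProdConvergent-oneMinus = ProdConvergent-AP oneMinus (λ c _ → oneMinus≡[]𝟙 c)

ProdConvergent-onePlus : ∀ a d → 1 ≤ a → 1 ≤ d → ProdConvergent (λ k → onePlus (a +ℕ d *ℕ k))
ProdConvergent-onePlus = ProdConvergent-AP onePlus (λ c _ → onePlus≡[]𝟙 c)

ProdConvergent-inv1m : ∀ a d → 1 ≤ a → 1 ≤ d → ProdConvergent (λ k → inv1m (a +ℕ d *ℕ k))
ProdConvergent-inv1m = ProdConvergent-AP inv1m inv1m≡[]𝟙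

prodAP-front : ∀ G c s → ProdConvergent (λ k → G (c +ℕ s *ℕ k)) → prodAP G c s ≈ G c ⊛ prodAP G (c +ℕ s) s
prodAP-front G c s cv =
  ≈-trans (infProd-split cv 1)
   (⊛-cong (≈-trans (𝟙-⊛ _) (G-≡ (trans (cong (c +ℕ_) (NP.*-zeroʳ s)) (NP.+-identityʳ c))))
           (infProd-cong (λ k → G-≡ (c+s[1+k] k))))
  where
  G-≡ : ∀ {a b} → a ≡ b → G a ≈ G b
  G-≡ refl = ≈-refl
  c+s[1+k] : ∀ k → c +ℕ s *ℕ (1 +ℕ k) ≡ (c +ℕ s) +ℕ s *ℕ k
  c+s[1+k] k rewrite NP.*-suc s k = sym (NP.+-assoc c s (s *ℕ k))

prodAP≡[]𝟙 : ∀ G c s → (∀ a → c ≤ a → G a ≡[ a ] 𝟙) → prodAP G c s ≡[ c ] 𝟙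
prodAP≡[]𝟙 G c s G≡[]𝟙 = infProd≡[]𝟙 c (λ k → ≡[]-weaken c≤ (G≡[]𝟙 (c +ℕ s *ℕ k) c≤))
  where
  c≤ : ∀ {k} → c ≤ c +ℕ s *ℕ k
  c≤ = NP.m≤m+n c _

qPochInfPlus : ℕ → ℕ → PS
qPochInfPlus = prodAP onePlus

qPochInf-⊛-qPochInfInv : ∀ a d → 1 ≤ a → 1 ≤ d → qPochInf a d ⊛ qPochInfInv a d ≈ 𝟙
qPochInf-⊛-qPochInfInv a d a≥1 d≥1 =
  ≈-trans (≈-sym (infProd-⊛ (ProdConvergent-oneMinus a d a≥1 d≥1) (ProdConvergent-inv1m a d a≥1 d≥1)))
   (infProd-𝟙 (λ k → oneMinus-⊛-inv1m (a +ℕ d *ℕ k) (NP.≤-trans a≥1 (NP.m≤m+n a _))))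

qPochInf-⊛-qPochInfPlus : ∀ a d → 1 ≤ a → 1 ≤ d → qPochInf a d ⊛ qPochInfPlus a d ≈ qPochInf (a +ℕ a) (d +ℕ d)
qPochInf-⊛-qPochInfPlus a d a≥1 d≥1 =
  ≈-trans (≈-sym (infProd-⊛ (ProdConvergent-oneMinus a d a≥1 d≥1) (ProdConvergent-onePlus a d a≥1 d≥1)))
   (infProd-cong (λ k → ≈-trans (oneMinus-⊛-onePlus (a +ℕ d *ℕ k)) (oneMinus-≡ (double a d k))))
  where
  double : ∀ a d k → (a +ℕ d *ℕ k) +ℕ (a +ℕ d *ℕ k) ≡ (a +ℕ a) +ℕ (d +ℕ d) *ℕ k
  double = solveℕ

-- Infinite sums

Σ∞ : (ℕ → PS) → PS
Σ∞ c n = sumTo (suc n) (λ k → c k n)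

SumConvergent : (ℕ → PS) → Set
SumConvergent c = ∀ k → O k (c k)

SumConvergent-shift : ∀ m {c} → SumConvergent c → SumConvergent (λ k → c (m +ℕ k))
SumConvergent-shift m {c} cv k = O-weaken (NP.m≤n+m k m) (cv (m +ℕ k))

Σ∞≡sumTo : ∀ {c} → SumConvergent c → ∀ n M → n < M → Σ∞ c n ≡ sumTo M (λ k → c k n)
Σ∞≡sumTo {c} cv n M n<M = sym (sumTo-pad (suc n) M (λ k → c k n) (λ k p → cv k n p) n<M)

Σ∞-cong : ∀ {c d} → (∀ k → c k ≈ d k) → Σ∞ c ≈ Σ∞ d
Σ∞-cong e = mk≈ (λ n → sumTo-cong (suc n) (λ k → at (e k) n))

Σ∞-⊕ : ∀ c d → Σ∞ (λ k → c k ⊕ d k) ≈ Σ∞ c ⊕ Σ∞ d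
Σ∞-⊕ c d = mk≈ (λ n → sumTo-+ (suc n) (λ k → c k n) (λ k → d k n))

Σ∞-⊝ : ∀ c d → Σ∞ (λ k → c k ⊝ d k) ≈ Σ∞ c ⊝ Σ∞ d
Σ∞-⊝ c d = ≈-trans (Σ∞-⊕ c (λ k → ⊖ d k)) (⊕-cong (≈-refl {Σ∞ c}) (mk≈ (λ n → sumTo-neg (suc n) (λ k → d k n))))

O-Σ∞ : ∀ {c} m → (∀ k → O m (c k)) → O m (Σ∞ c)
O-Σ∞ {c} m o n p = sumTo-zero (suc n) (λ k _ → o k n p)

⊛-Σ∞ : ∀ f {c} → SumConvergent c → f ⊛ Σ∞ c ≈ Σ∞ (λ k → f ⊛ c k)
⊛-Σ∞ f {c} cv = mk≈ λ n → begin
  sumTo (suc n) (λ j → f j * Σ∞ c (n ∸ j))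
    ≡⟨ sumTo-cong< (suc n) (λ j j<n → cong (f j *_) (Σ∞≡sumTo cv (n ∸ j) (suc n) (s≤s (NP.m∸n≤m n j)))) ⟩
  sumTo (suc n) (λ j → f j * sumTo (suc n) (λ k → c k (n ∸ j)))
    ≡⟨ sumTo-cong (suc n) (λ j → sym (sumTo-*ˡ (suc n) (f j) (λ k → c k (n ∸ j)))) ⟩
  sumTo (suc n) (λ j → sumTo (suc n) (λ k → f j * c k (n ∸ j)))
    ≡⟨ sumTo-swap (suc n) (suc n) (λ j k → f j * c k (n ∸ j)) ⟩
  Σ∞ (λ k → f ⊛ c k) n
    ∎
  where open ≡-Reasoning

Σ∞-front : ∀ {c} → SumConvergent c → Σ∞ c ≈ c 0 ⊕ Σ∞ (λ k → c (suc k))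
Σ∞-front {c} cv = mk≈ λ n →
  trans (sumTo-front n (λ k → c k n))
        (cong (c 0 n +_) (sym (trans (cong (sumTo n (λ k → c (suc k) n) +_) (cv (suc n) n NP.≤-refl)) (ZP.+-identityʳ _))))

Σ∞-drop : ∀ {c} → SumConvergent c → ∀ m → (∀ k → k < m → c k ≈ 𝟘) → Σ∞ c ≈ Σ∞ (λ k → c (m +ℕ k))
Σ∞-drop {c} cv zero    z = ≈-refl
Σ∞-drop {c} cv (suc m) z = begin
  Σ∞ c                                   ≈⟨ Σ∞-front cv ⟩
  c 0 ⊕ Σ∞ (λ k → c (suc k))             ≈⟨ ⊕-cong (z 0 (s≤s z≤n)) ≈-refl ⟩
  𝟘 ⊕ Σ∞ (λ k → c (suc k))               ≈⟨ mk≈ (λ n → ZP.+-identityˡ _) ⟩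
  Σ∞ (λ k → c (suc k))                   ≈⟨ Σ∞-drop (SumConvergent-shift 1 cv) m (λ k p → z (suc k) (s≤s p)) ⟩
  Σ∞ (λ k → c (suc m +ℕ k))              ∎
  where open ≈-Reasoning

Σ∞≡[]head : ∀ {c f} N → SumConvergent c → c 0 ≈ f → (∀ k → O N (c (suc k))) → Σ∞ c ≡[ N ] f
Σ∞≡[]head {c} {f} N cv c₀≈f o n p =
  trans (at (Σ∞-front cv) n)
   (trans (cong₂ _+_ (at c₀≈f n) (O-Σ∞ {λ k → c (suc k)} N o n p)) (ZP.+-identityʳ (f n)))

Σ∞-swap : ∀ (c : ℕ → ℕ → PS) → Σ∞ (λ i → Σ∞ (λ j → c i j)) ≈ Σ∞ (λ j → Σ∞ (λ i → c i j))
Σ∞-swap c = mk≈ (λ n → sumTo-swap (suc n) (suc n) (λ i j → c i j n))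

Σ∞-interleave : ∀ {c} → SumConvergent c → Σ∞ c ≈ Σ∞ (λ k → c (k +ℕ k)) ⊕ Σ∞ (λ k → c (suc (k +ℕ k)))
Σ∞-interleave {c} cv = mk≈ λ n →
  trans (Σ∞≡sumTo cv n (suc n +ℕ suc n) (NP.≤-trans (NP.n<1+n n) (NP.m≤m+n (suc n) (suc n))))
        (sumTo-interleave (suc n) (λ k → c k n))

Σ∞-⊛-Σ∞ : ∀ {a b} → SumConvergent a → SumConvergent b → Σ∞ a ⊛ Σ∞ b ≈ Σ∞ (λ i → Σ∞ (λ j → a i ⊛ b j))
Σ∞-⊛-Σ∞ {a} {b} cva cvb = begin
  Σ∞ a ⊛ Σ∞ b                          ≈⟨ ⊛-Σ∞ (Σ∞ a) cvb ⟩
  Σ∞ (λ j → Σ∞ a ⊛ b j)                ≈⟨ Σ∞-cong (λ j → ≈-trans (⊛-comm (Σ∞ a) (b j)) (⊛-Σ∞ (b j) cva)) ⟩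
  Σ∞ (λ j → Σ∞ (λ i → b j ⊛ a i))      ≈⟨ Σ∞-cong (λ j → Σ∞-cong (λ i → ⊛-comm (b j) (a i))) ⟩
  Σ∞ (λ j → Σ∞ (λ i → a i ⊛ b j))      ≈⟨ Σ∞-swap (λ j i → a i ⊛ b j) ⟩
  Σ∞ (λ i → Σ∞ (λ j → a i ⊛ b j))      ∎
  where open ≈-Reasoning

-- Defs.dsum c is Σ∞₂ c by definition; in particular LHS = Σ∞₂ summand.
Σ∞₂ : (ℕ → ℕ → PS) → PS
Σ∞₂ c = Σ∞ (λ i → Σ∞ (λ j → c i j))

SumConvergent₂ : (ℕ → ℕ → PS) → Set
SumConvergent₂ c = ∀ a b → O a (c a b) × O b (c a b)

when : {P : Set} → Dec P → PS → PS
when (yes _) f = f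
when (no _)  f = 𝟘

O-when : ∀ {P : Set} (d : Dec P) {f} k → O k f → O k (when d f)
O-when (yes _) k o     = o
O-when (no _)  k o n _ = refl

when-yes : ∀ {P : Set} (d : Dec P) f → P → when d f ≈ f
when-yes (yes _) f _ = ≈-refl
when-yes (no ¬p) f p = ⊥-elim (¬p p)

when-no : ∀ {P : Set} (d : Dec P) f → ¬ P → when d f ≈ 𝟘
when-no (yes p) f ¬p = ⊥-elim (¬p p)
when-no (no _)  f _  = ≈-refl

when-≤-⊕-when-> : ∀ a b f → f ≈ when (b N.≤? a) f ⊕ when (a N.<? b) f
when-≤-⊕-when-> a b f with b N.≤? a | a N.<? b
... | yes b≤a | yes a<b = ⊥-elim (NP.<⇒≱ a<b b≤a)
... | yes _   | no _    = mk≈ (λ n → sym (ZP.+-identityʳ (f n)))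
... | no _    | yes _   = mk≈ (λ n → sym (ZP.+-identityˡ (f n)))
... | no b≰a  | no a≮b  = ⊥-elim (b≰a (NP.≮⇒≥ a≮b))

diagonal : (ℕ → ℕ → PS) → ℕ → PS
diagonal c n = Σ∞ (λ b → c (b +ℕ n) b)

Σ∞₂-diagonals : ∀ c → SumConvergent₂ c →
  Σ∞₂ c ≈ Σ∞ (diagonal c) ⊕ Σ∞ (λ n → Σ∞ (λ a → c a (a +ℕ suc n)))
Σ∞₂-diagonals c cv = begin
  Σ∞₂ c                                         ≈⟨ Σ∞-cong (λ a → Σ∞-cong (λ b → when-≤-⊕-when-> a b (c a b))) ⟩
  Σ∞ (λ a → Σ∞ (λ b → lower a b ⊕ upper a b))   ≈⟨ Σ∞-cong (λ a → Σ∞-⊕ (lower a) (upper a)) ⟩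
  Σ∞ (λ a → Σ∞ (lower a) ⊕ Σ∞ (upper a))        ≈⟨ Σ∞-⊕ (λ a → Σ∞ (lower a)) (λ a → Σ∞ (upper a)) ⟩
  Σ∞₂ lower ⊕ Σ∞₂ upper                         ≈⟨ ⊕-cong lower-diagonals upper-diagonals ⟩
  Σ∞ (λ n → Σ∞ (λ b → c (b +ℕ n) b)) ⊕ Σ∞ (λ n → Σ∞ (λ a → c a (a +ℕ suc n)))   ∎
  where
  open ≈-Reasoning
  lower upper : ℕ → ℕ → PS
  lower a b = when (b N.≤? a) (c a b)
  upper a b = when (a N.<? b) (c a b)
  lower-diagonals : Σ∞₂ lower ≈ Σ∞ (λ n → Σ∞ (λ b → c (b +ℕ n) b))
  lower-diagonals = begin
    Σ∞₂ lower
      ≈⟨ Σ∞-swap lower ⟩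
    Σ∞ (λ b → Σ∞ (λ a → lower a b))
      ≈⟨ Σ∞-cong (λ b → Σ∞-drop (λ a → O-when (b N.≤? a) a (proj₁ (cv a b))) b
          (λ a a<b → when-no (b N.≤? a) (c a b) (NP.<⇒≱ a<b))) ⟩
    Σ∞ (λ b → Σ∞ (λ n → lower (b +ℕ n) b))
      ≈⟨ Σ∞-cong (λ b → Σ∞-cong (λ n → when-yes (b N.≤? (b +ℕ n)) (c (b +ℕ n) b) (NP.m≤m+n b n))) ⟩
    Σ∞ (λ b → Σ∞ (λ n → c (b +ℕ n) b))
      ≈⟨ Σ∞-swap (λ b n → c (b +ℕ n) b) ⟩
    Σ∞ (λ n → Σ∞ (λ b → c (b +ℕ n) b))
      ∎
  upper-diagonals : Σ∞₂ upper ≈ Σ∞ (λ n → Σ∞ (λ a → c a (a +ℕ suc n)))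
  upper-diagonals = begin
    Σ∞₂ upper
      ≈⟨ Σ∞-cong (λ a → Σ∞-drop (λ b → O-when (a N.<? b) b (proj₂ (cv a b))) (suc a)
          (λ b b<1+a → when-no (a N.<? b) (c a b) (NP.<⇒≱ b<1+a))) ⟩
    Σ∞ (λ a → Σ∞ (λ n → upper a (suc a +ℕ n)))
      ≈⟨ Σ∞-cong (λ a → Σ∞-cong (λ n → when-yes (a N.<? (suc a +ℕ n)) (c a (suc a +ℕ n)) (NP.m≤m+n (suc a) n))) ⟩
    Σ∞ (λ a → Σ∞ (λ n → c a (suc a +ℕ n)))
      ≈⟨ Σ∞-cong (λ a → Σ∞-cong (λ n → ≈-reflexive (cong (c a) (sym (NP.+-suc a n))))) ⟩
    Σ∞ (λ a → Σ∞ (λ n → c a (a +ℕ suc n)))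
      ≈⟨ Σ∞-swap (λ a n → c a (a +ℕ suc n)) ⟩
    Σ∞ (λ n → Σ∞ (λ a → c a (a +ℕ suc n)))
      ∎

Σ∞₂-symmetric-diagonals : ∀ c → SumConvergent₂ c → (∀ a b → c a b ≈ c b a) →
  Σ∞₂ c ⊕ Σ∞ (λ b → c b b) ≈ Σ∞ (diagonal c) ⊕ Σ∞ (diagonal c)
Σ∞₂-symmetric-diagonals c cv symm = begin
  Σ∞₂ c ⊕ Σ∞ (λ b → c b b)
    ≈⟨ ⊕-cong (Σ∞₂-diagonals c cv) diagonal₀ ⟩
  (Σ∞ R ⊕ Σ∞ (λ n → Σ∞ (λ a → c a (a +ℕ suc n)))) ⊕ R 0
    ≈⟨ ⊕-cong (⊕-cong (≈-refl {Σ∞ R}) (Σ∞-cong (λ n → Σ∞-cong (λ a → symm a (a +ℕ suc n))))) ≈-refl ⟩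
  (Σ∞ R ⊕ Σ∞ (λ n → R (suc n))) ⊕ R 0
    ≈⟨ mk≈ (λ n → ZP.+-assoc (Σ∞ R n) _ _) ⟩
  Σ∞ R ⊕ (Σ∞ (λ n → R (suc n)) ⊕ R 0)
    ≈⟨ ⊕-cong (≈-refl {Σ∞ R}) (mk≈ (λ n → ZP.+-comm (Σ∞ (λ m → R (suc m)) n) (R 0 n))) ⟩
  Σ∞ R ⊕ (R 0 ⊕ Σ∞ (λ n → R (suc n)))
    ≈⟨ ⊕-cong (≈-refl {Σ∞ R}) (≈-sym (Σ∞-front cvR)) ⟩
  Σ∞ R ⊕ Σ∞ R
    ∎
  where
  open ≈-Reasoning
  R : ℕ → PS
  R = diagonal c
  diagonal₀ : Σ∞ (λ b → c b b) ≈ R 0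
  diagonal₀ = Σ∞-cong (λ b → ≈-reflexive (cong (λ x → c x b) (sym (NP.+-identityʳ b))))
  cvR : SumConvergent R
  cvR n = O-Σ∞ n (λ b → O-weaken (NP.m≤n+m n b) (proj₁ (cv (b +ℕ n) b)))

Σ∞-factor-front : ∀ {d u} m → SumConvergent d → SumConvergent u →
  d 0 ≈ 𝟘 → (∀ k → d (suc k) ≈ m ⊛ u k) → Σ∞ d ≈ m ⊛ Σ∞ u
Σ∞-factor-front {d} {u} m cvd cvu d₀≈𝟘 d-suc = begin
  Σ∞ d                             ≈⟨ Σ∞-front cvd ⟩
  d 0 ⊕ Σ∞ (λ k → d (suc k))       ≈⟨ ⊕-cong d₀≈𝟘 (Σ∞-cong d-suc) ⟩
  𝟘 ⊕ Σ∞ (λ k → m ⊛ u k)           ≈⟨ mk≈ (λ n → ZP.+-identityˡ _) ⟩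
  Σ∞ (λ k → m ⊛ u k)               ≈⟨ ≈-sym (⊛-Σ∞ m cvu) ⟩
  m ⊛ Σ∞ u                         ∎
  where open ≈-Reasoning

-- Uniqueness of solutions of q-difference equations in the parameter c

-- Δ c = X c - Y c satisfies Δ c = g c Δ (c + s) and Δ c = O(q^c), so Δ c = O(q^(c + M)) for every M.
q-difference-unique : ∀ s → 1 ≤ s → (X Y g : ℕ → PS) →
  (∀ c → 1 ≤ c → X c ≈ g c ⊛ X (c +ℕ s)) → (∀ c → 1 ≤ c → Y c ≈ g c ⊛ Y (c +ℕ s)) →
  (∀ c → 1 ≤ c → X c ≡[ c ] Y c) → ∀ c → 1 ≤ c → X c ≈ Y c
q-difference-unique s s≥1 X Y g X-rec Y-rec X≡[]Y c c≥1 =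
  mk≈ (λ n → O⇒≡[] {X c} {Y c} (O-Δ (suc n) c c≥1) n (NP.≤-trans (NP.n<1+n n) (NP.m≤n+m (suc n) c)))
  where
  Δ : ℕ → PS
  Δ c = X c ⊝ Y c
  Δ-rec : ∀ c → 1 ≤ c → Δ c ≈ g c ⊛ Δ (c +ℕ s)
  Δ-rec c c≥1 = ≈-trans (⊕-cong (X-rec c c≥1) (⊖-cong (Y-rec c c≥1)))
    (solve 3 (λ g x y → g :* x :- g :* y := g :* (x :- y)) ≈-refl (g c) (X (c +ℕ s)) (Y (c +ℕ s)))
  O-Δ : ∀ M c → 1 ≤ c → O (c +ℕ M) (Δ c)
  O-Δ zero    c c≥1 rewrite NP.+-identityʳ c = ≡[]⇒O {X c} {Y c} (X≡[]Y c c≥1)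
  O-Δ (suc M) c c≥1 =
    O-weaken c+[1+M]≤ (O-resp-≈ (≈-sym (Δ-rec c c≥1))
      (O-⊛ʳ ((c +ℕ s) +ℕ M) (g c) (Δ (c +ℕ s)) (O-Δ M (c +ℕ s) (NP.≤-trans c≥1 (NP.m≤m+n c s)))))
    where
    c+[1+M]≤ : c +ℕ suc M ≤ (c +ℕ s) +ℕ M
    c+[1+M]≤ rewrite NP.+-assoc c s M = NP.+-monoʳ-≤ c (NP.+-monoˡ-≤ M s≥1)

-- The q-binomial theorem and Euler's identities

invPoch : ℕ → ℕ → PS
invPoch s k = qPochFinInv s s k

poch : PS → ℕ → ℕ → PS
poch α s k = prodTo k (λ j → 𝟙 ⊝ α ⊛ mono (s *ℕ j))

oneMinus-⊛-invPoch : ∀ s k → 1 ≤ s → oneMinus (s *ℕ suc k) ⊛ invPoch s (suc k) ≈ invPoch s k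
oneMinus-⊛-invPoch s k s≥1 rewrite NP.*-suc s k = begin
  o ⊛ (invPoch s k ⊛ i)     ≈⟨ solve 3 (λ o p i → o :* (p :* i) := p :* (i :* o)) ≈-refl o (invPoch s k) i ⟩
  invPoch s k ⊛ (i ⊛ o)     ≈⟨ ⊛-congʳ (invPoch s k) (inv1m-⊛-oneMinus (s +ℕ s *ℕ k) (NP.≤-trans s≥1 (NP.m≤m+n s _))) ⟩
  invPoch s k ⊛ 𝟙           ≈⟨ ⊛-𝟙 (invPoch s k) ⟩
  invPoch s k               ∎
  where
  open ≈-Reasoning
  o i : PS
  o = oneMinus (s +ℕ s *ℕ k)
  i = inv1m (s +ℕ s *ℕ k)

oneMinus-*0-⊛ : ∀ s f → oneMinus (s *ℕ 0) ⊛ f ≈ 𝟘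
oneMinus-*0-⊛ s f = ≈-trans (⊛-congˡ (≈-trans (oneMinus-≡ (NP.*-zeroʳ s)) oneMinus-zero) f) (𝟘-⊛ f)

k≤c*k : ∀ c k → 1 ≤ c → k ≤ c *ℕ k
k≤c*k c k c≥1 = NP.m≤n*m k c {{N.>-nonZero c≥1}}

k≤k*k : ∀ k → k ≤ k *ℕ k
k≤k*k zero    = z≤n
k≤k*k (suc k) = NP.m≤m+n (suc k) (k *ℕ suc k)

qBinomialTerm : ℕ → PS → ℕ → ℕ → PS
qBinomialTerm s α c k = poch α s k ⊛ (mono (c *ℕ k) ⊛ invPoch s k)

qBinomialSeries : ℕ → PS → ℕ → PS
qBinomialSeries s α c = Σ∞ (qBinomialTerm s α c)

SumConvergent-qBinomialTerm : ∀ s α c → 1 ≤ c → SumConvergent (qBinomialTerm s α c)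
SumConvergent-qBinomialTerm s α c c≥1 k =
  O-⊛ʳ k (poch α s k) _ (O-mono-⊛-≤ (invPoch s k) (k≤c*k c k c≥1))

qBinomialSeries≡[]𝟙 : ∀ s α c → 1 ≤ c → qBinomialSeries s α c ≡[ c ] 𝟙
qBinomialSeries≡[]𝟙 s α c c≥1 = Σ∞≡[]head c (SumConvergent-qBinomialTerm s α c c≥1) term₀
  (λ k → O-⊛ʳ c (poch α s (suc k)) _ (O-mono-⊛-≤ (invPoch s (suc k)) (NP.m≤m*n c (suc k))))
  where
  term₀ : qBinomialTerm s α c 0 ≈ 𝟙
  term₀ = ≈-trans (𝟙-⊛ (mono (c *ℕ 0) ⊛ 𝟙))
            (≈-trans (⊛-𝟙 (mono (c *ℕ 0))) (≈-trans (mono-≡ (NP.*-zeroʳ c)) mono-zero))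

module _ (s : ℕ) (α : PS) (c : ℕ) where

  qBinomialGap : ℕ → PS
  qBinomialGap k = poch α s k ⊛ (mono (c *ℕ k) ⊛ (oneMinus (s *ℕ k) ⊛ invPoch s k))

  qBinomialTerm-⊝ : ∀ k → qBinomialTerm s α c k ⊝ qBinomialTerm s α (c +ℕ s) k ≈ qBinomialGap k
  qBinomialTerm-⊝ k =
    ≈-trans (⊕-cong (≈-refl {qBinomialTerm s α c k})
                    (⊖-cong (⊛-congʳ (poch α s k) (⊛-congˡ (mono-split _ (c *ℕ k) (s *ℕ k) (NP.*-distribʳ-+ k c s)) (invPoch s k)))))
     (solve 4 (λ a m n p → a :* (m :* p) :- a :* ((m :* n) :* p) := a :* (m :* ((con 1ℤ :- n) :* p))) ≈-refl
        (poch α s k) (mono (c *ℕ k)) (mono (s *ℕ k)) (invPoch s k))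

  qBinomialGap-zero : qBinomialGap 0 ≈ 𝟘
  qBinomialGap-zero =
    ≈-trans (⊛-congʳ (poch α s 0) (≈-trans (⊛-congʳ (mono (c *ℕ 0)) (oneMinus-*0-⊛ s (invPoch s 0))) (⊛-𝟘 (mono (c *ℕ 0)))))
            (⊛-𝟘 (poch α s 0))

  -- Uses (α;q^s)_{k+1} = (α;q^s)_k (1 - α q^{sk}) and (1 - q^{s(k+1)}) / (q^s;q^s)_{k+1} = 1 / (q^s;q^s)_k.
  qBinomialGap-suc : 1 ≤ s → ∀ k →
    qBinomialGap (suc k) ≈ mono c ⊛ (qBinomialTerm s α c k ⊝ α ⊛ qBinomialTerm s α (c +ℕ s) k)
  qBinomialGap-suc s≥1 k = begin
    (A ⊛ (𝟙 ⊝ α ⊛ n)) ⊛ (mono (c *ℕ suc k) ⊛ (oneMinus (s *ℕ suc k) ⊛ invPoch s (suc k)))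
      ≈⟨ ⊛-congʳ (A ⊛ (𝟙 ⊝ α ⊛ n)) (⊛-cong (mono-split _ c (c *ℕ k) (NP.*-suc c k)) (oneMinus-⊛-invPoch s k s≥1)) ⟩
    (A ⊛ (𝟙 ⊝ α ⊛ n)) ⊛ ((mono c ⊛ m) ⊛ P)
      ≈⟨ solve 6 (λ a al n mc m p → (a :* (con 1ℤ :- al :* n)) :* ((mc :* m) :* p)
                                    := mc :* (a :* (m :* p) :- al :* (a :* ((m :* n) :* p)))) ≈-refl
           A α n (mono c) m P ⟩
    mono c ⊛ (A ⊛ (m ⊛ P) ⊝ α ⊛ (A ⊛ ((m ⊛ n) ⊛ P)))
      ≈⟨ ⊛-congʳ (mono c) (⊕-cong (≈-refl {A ⊛ (m ⊛ P)})
           (⊖-cong (⊛-congʳ α (⊛-congʳ A (⊛-congˡ (≈-sym (mono-split _ (c *ℕ k) (s *ℕ k) (NP.*-distribʳ-+ k c s))) P))))) ⟩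
    mono c ⊛ (qBinomialTerm s α c k ⊝ α ⊛ qBinomialTerm s α (c +ℕ s) k)
      ∎
    where
    open ≈-Reasoning
    A m n P : PS
    A = poch α s k
    m = mono (c *ℕ k)
    n = mono (s *ℕ k)
    P = invPoch s k

  qBinomialSeries-⊝ : 1 ≤ s → 1 ≤ c →
    qBinomialSeries s α c ⊝ qBinomialSeries s α (c +ℕ s) ≈ mono c ⊛ (qBinomialSeries s α c ⊝ α ⊛ qBinomialSeries s α (c +ℕ s))
  qBinomialSeries-⊝ s≥1 c≥1 = begin
    Σ∞ T ⊝ Σ∞ T'
      ≈⟨ ≈-sym (Σ∞-⊝ T T') ⟩
    Σ∞ (λ k → T k ⊝ T' k)
      ≈⟨ Σ∞-cong qBinomialTerm-⊝ ⟩
    Σ∞ qBinomialGap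
      ≈⟨ Σ∞-factor-front (mono c) cvGap cvU qBinomialGap-zero (qBinomialGap-suc s≥1) ⟩
    mono c ⊛ Σ∞ U
      ≈⟨ ⊛-congʳ (mono c) (Σ∞-⊝ T (λ k → α ⊛ T' k)) ⟩
    mono c ⊛ (Σ∞ T ⊝ Σ∞ (λ k → α ⊛ T' k))
      ≈⟨ ⊛-congʳ (mono c) (⊕-cong (≈-refl {Σ∞ T}) (⊖-cong (≈-sym (⊛-Σ∞ α cvT')))) ⟩
    mono c ⊛ (Σ∞ T ⊝ α ⊛ Σ∞ T')
      ∎
    where
    open ≈-Reasoning
    T T' U : ℕ → PS
    T = qBinomialTerm s α c
    T' = qBinomialTerm s α (c +ℕ s)
    U k = T k ⊝ α ⊛ T' k
    cvT : SumConvergent T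
    cvT = SumConvergent-qBinomialTerm s α c c≥1
    cvT' : SumConvergent T'
    cvT' = SumConvergent-qBinomialTerm s α (c +ℕ s) (NP.≤-trans c≥1 (NP.m≤m+n c s))
    cvU : SumConvergent U
    cvU k = O-⊝ k (T k) (α ⊛ T' k) (cvT k) (O-⊛ʳ k α (T' k) (cvT' k))
    cvGap : SumConvergent qBinomialGap
    cvGap k = O-⊛ʳ k (poch α s k) _ (O-mono-⊛-≤ (oneMinus (s *ℕ k) ⊛ invPoch s k) (k≤c*k c k c≥1))

  qBinomialSeries-rec : 1 ≤ s → 1 ≤ c →
    qBinomialSeries s α c ≈ (inv1m c ⊛ (𝟙 ⊝ α ⊛ mono c)) ⊛ qBinomialSeries s α (c +ℕ s)
  qBinomialSeries-rec s≥1 c≥1 =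
    ≈-trans (oneMinus-⊛⇒inv1m c H _ c≥1 (rearrange (qBinomialSeries-⊝ s≥1 c≥1)))
            (≈-sym (⊛-assoc (inv1m c) (𝟙 ⊝ α ⊛ mono c) H'))
    where
    H H' : PS
    H = qBinomialSeries s α c
    H' = qBinomialSeries s α (c +ℕ s)
    rearrange : H ⊝ H' ≈ mono c ⊛ (H ⊝ α ⊛ H') → oneMinus c ⊛ H ≈ (𝟙 ⊝ α ⊛ mono c) ⊛ H'
    rearrange e = begin
      oneMinus c ⊛ H
        ≈⟨ solve 4 (λ X Y m a → (con 1ℤ :- m) :* X := ((X :- Y) :- m :* (X :- a :* Y)) :+ (con 1ℤ :- a :* m) :* Y)
                   ≈-refl H H' (mono c) α ⟩
      ((H ⊝ H') ⊝ mono c ⊛ (H ⊝ α ⊛ H')) ⊕ (𝟙 ⊝ α ⊛ mono c) ⊛ H'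
        ≈⟨ ⊕-cong (mk≈ (λ n → trans (cong (_- G n) (at e n)) (ZP.+-inverseʳ (G n)))) ≈-refl ⟩
      𝟘 ⊕ (𝟙 ⊝ α ⊛ mono c) ⊛ H'
        ≈⟨ mk≈ (λ n → ZP.+-identityˡ _) ⟩
      (𝟙 ⊝ α ⊛ mono c) ⊛ H'
        ∎
      where
      open ≈-Reasoning
      G : PS
      G = mono c ⊛ (H ⊝ α ⊛ H')

𝟙⊝𝟘⊛ : ∀ f → 𝟙 ⊝ 𝟘 ⊛ f ≈ 𝟙
𝟙⊝𝟘⊛ f = mk≈ (λ n → trans (cong (λ x → 𝟙 n - x) (at (𝟘-⊛ f) n)) (ZP.+-identityʳ (𝟙 n)))

poch-𝟘 : ∀ s k → poch 𝟘 s k ≈ 𝟙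
poch-𝟘 s k = prodTo-𝟙 k _ (λ j → 𝟙⊝𝟘⊛ (mono (s *ℕ j)))

poch-mono : ∀ s e k → poch (mono e) s k ≈ qPochFin e s k
poch-mono s e k = prodTo-cong k (λ j _ → ⊕-cong (≈-refl {𝟙}) (⊖-cong (mono-+ e (s *ℕ j))))

qPochInfInv≡[]𝟙 : ∀ c s → 1 ≤ c → qPochInfInv c s ≡[ c ] 𝟙
qPochInfInv≡[]𝟙 c s c≥1 = prodAP≡[]𝟙 inv1m c s (λ a c≤a → inv1m≡[]𝟙 a (NP.≤-trans c≥1 c≤a))

euler₁ : ∀ s c → 1 ≤ s → 1 ≤ c → qBinomialSeries s 𝟘 c ≈ qPochInfInv c s
euler₁ s c s≥1 c≥1 =
  q-difference-unique s s≥1 (qBinomialSeries s 𝟘) (λ c → qPochInfInv c s) inv1m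
    (λ c c≥1 → ≈-trans (qBinomialSeries-rec s 𝟘 c s≥1 c≥1)
                        (⊛-congˡ (≈-trans (⊛-congʳ (inv1m c) (𝟙⊝𝟘⊛ (mono c))) (⊛-𝟙 (inv1m c)))
                                 (qBinomialSeries s 𝟘 (c +ℕ s))))
    (λ c c≥1 → prodAP-front inv1m c s (ProdConvergent-inv1m c s c≥1 s≥1))
    (λ c c≥1 → ≡[]-trans (qBinomialSeries≡[]𝟙 s 𝟘 c c≥1) (≡[]-sym (qPochInfInv≡[]𝟙 c s c≥1)))
    c c≥1

q-binomial : ∀ s e c → 1 ≤ s → 1 ≤ c → qBinomialSeries s (mono e) c ≈ qPochInf (c +ℕ e) s ⊛ qPochInfInv c s
q-binomial s e c s≥1 c≥1 =
  q-difference-unique s s≥1 (qBinomialSeries s (mono e)) Y (λ c → inv1m c ⊛ (𝟙 ⊝ mono e ⊛ mono c))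
    (λ c c≥1 → qBinomialSeries-rec s (mono e) c s≥1 c≥1) Y-rec
    (λ c c≥1 → ≡[]-trans (qBinomialSeries≡[]𝟙 s (mono e) c c≥1)
                 (≡[]-sym (≡[]-⊛-𝟙 c (≡[]-weaken (NP.m≤m+n c e) (prodAP≡[]𝟙 oneMinus (c +ℕ e) s (λ a _ → oneMinus≡[]𝟙 a)))
                                      (qPochInfInv≡[]𝟙 c s c≥1))))
    c c≥1
  where
  Y : ℕ → PS
  Y c = qPochInf (c +ℕ e) s ⊛ qPochInfInv c s
  Y-rec : ∀ c → 1 ≤ c → Y c ≈ (inv1m c ⊛ (𝟙 ⊝ mono e ⊛ mono c)) ⊛ Y (c +ℕ s)
  Y-rec c c≥1 = begin
    Y c
      ≈⟨ ⊛-cong (prodAP-front oneMinus (c +ℕ e) s (ProdConvergent-oneMinus (c +ℕ e) s (NP.≤-trans c≥1 (NP.m≤m+n c e)) s≥1))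
                (prodAP-front inv1m c s (ProdConvergent-inv1m c s c≥1 s≥1)) ⟩
    (oneMinus (c +ℕ e) ⊛ qPochInf ((c +ℕ e) +ℕ s) s) ⊛ (inv1m c ⊛ qPochInfInv (c +ℕ s) s)
      ≈⟨ solve 4 (λ o p i r → (o :* p) :* (i :* r) := (i :* o) :* (p :* r)) ≈-refl
           (oneMinus (c +ℕ e)) (qPochInf ((c +ℕ e) +ℕ s) s) (inv1m c) (qPochInfInv (c +ℕ s) s) ⟩
    (inv1m c ⊛ oneMinus (c +ℕ e)) ⊛ (qPochInf ((c +ℕ e) +ℕ s) s ⊛ qPochInfInv (c +ℕ s) s)
      ≈⟨ ⊛-cong (⊛-congʳ (inv1m c) (⊕-cong (≈-refl {𝟙}) (⊖-cong (mono-split (c +ℕ e) e c (NP.+-comm c e)))))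
                (⊛-congˡ (infProd-cong (λ k → oneMinus-≡ (cong (_+ℕ s *ℕ k) (+-right-comm c e s)))) (qPochInfInv (c +ℕ s) s)) ⟩
    (inv1m c ⊛ (𝟙 ⊝ mono e ⊛ mono c)) ⊛ Y (c +ℕ s)
      ∎
    where
    open ≈-Reasoning
    +-right-comm : ∀ a b c → (a +ℕ b) +ℕ c ≡ (a +ℕ c) +ℕ b
    +-right-comm = solveℕ

-- tri k = k (k - 1) / 2
tri : ℕ → ℕ
tri zero    = 0
tri (suc k) = tri k +ℕ k

euler₂Term : ℕ → ℕ → ℕ → PS
euler₂Term s c k = mono (c *ℕ k +ℕ s *ℕ tri k) ⊛ invPoch s k

euler₂Series : ℕ → ℕ → PS
euler₂Series s c = Σ∞ (euler₂Term s c)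

O-euler₂Term : ∀ s c k → 1 ≤ c → O (c *ℕ k) (euler₂Term s c k)
O-euler₂Term s c k c≥1 = O-mono-⊛-≤ (invPoch s k) (NP.m≤m+n (c *ℕ k) _)

SumConvergent-euler₂Term : ∀ s c → 1 ≤ c → SumConvergent (euler₂Term s c)
SumConvergent-euler₂Term s c c≥1 k = O-weaken (k≤c*k c k c≥1) (O-euler₂Term s c k c≥1)

euler₂Series≡[]𝟙 : ∀ s c → 1 ≤ c → euler₂Series s c ≡[ c ] 𝟙
euler₂Series≡[]𝟙 s c c≥1 = Σ∞≡[]head c (SumConvergent-euler₂Term s c c≥1) term₀
  (λ k → O-weaken (NP.m≤m*n c (suc k)) (O-euler₂Term s c (suc k) c≥1))
  where
  term₀ : euler₂Term s c 0 ≈ 𝟙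
  term₀ = ≈-trans (⊛-𝟙 (mono (c *ℕ 0 +ℕ s *ℕ 0))) (≈-trans (mono-≡ (cong₂ _+ℕ_ (NP.*-zeroʳ c) (NP.*-zeroʳ s))) mono-zero)

euler₂Series-⊝ : ∀ s c → 1 ≤ s → 1 ≤ c → euler₂Series s c ⊝ euler₂Series s (c +ℕ s) ≈ mono c ⊛ euler₂Series s (c +ℕ s)
euler₂Series-⊝ s c s≥1 c≥1 = begin
  Σ∞ T ⊝ Σ∞ T'
    ≈⟨ ≈-sym (Σ∞-⊝ T T') ⟩
  Σ∞ (λ k → T k ⊝ T' k)
    ≈⟨ Σ∞-cong term-⊝ ⟩
  Σ∞ gap
    ≈⟨ Σ∞-factor-front (mono c) cvGap (SumConvergent-euler₂Term s (c +ℕ s) (NP.≤-trans c≥1 (NP.m≤m+n c s))) gap-zero gap-suc ⟩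
  mono c ⊛ Σ∞ T'
    ∎
  where
  open ≈-Reasoning
  T T' : ℕ → PS
  T = euler₂Term s c
  T' = euler₂Term s (c +ℕ s)
  e : ℕ → ℕ
  e k = c *ℕ k +ℕ s *ℕ tri k
  gap : ℕ → PS
  gap k = mono (e k) ⊛ (oneMinus (s *ℕ k) ⊛ invPoch s k)
  cvGap : SumConvergent gap
  cvGap k = O-mono-⊛-≤ (oneMinus (s *ℕ k) ⊛ invPoch s k) (NP.≤-trans (k≤c*k c k c≥1) (NP.m≤m+n (c *ℕ k) _))
  term-⊝ : ∀ k → T k ⊝ T' k ≈ gap k
  term-⊝ k =
    ≈-trans (⊕-cong (≈-refl {T k}) (⊖-cong (⊛-congˡ (mono-split _ (e k) (s *ℕ k) (exponent c s k (tri k))) (invPoch s k))))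
     (solve 3 (λ m n p → m :* p :- (m :* n) :* p := m :* ((con 1ℤ :- n) :* p)) ≈-refl (mono (e k)) (mono (s *ℕ k)) (invPoch s k))
    where
    exponent : ∀ c s k t → (c +ℕ s) *ℕ k +ℕ s *ℕ t ≡ (c *ℕ k +ℕ s *ℕ t) +ℕ s *ℕ k
    exponent = solveℕ
  gap-zero : gap 0 ≈ 𝟘
  gap-zero = ≈-trans (⊛-congʳ (mono (e 0)) (oneMinus-*0-⊛ s (invPoch s 0))) (⊛-𝟘 (mono (e 0)))
  gap-suc : ∀ k → gap (suc k) ≈ mono c ⊛ T' k
  gap-suc k = begin
    mono (e (suc k)) ⊛ (oneMinus (s *ℕ suc k) ⊛ invPoch s (suc k))
      ≈⟨ ⊛-cong (mono-split _ c _ (exponent c s k (tri k))) (oneMinus-⊛-invPoch s k s≥1) ⟩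
    (mono c ⊛ mono ((c +ℕ s) *ℕ k +ℕ s *ℕ tri k)) ⊛ invPoch s k
      ≈⟨ ⊛-assoc (mono c) (mono ((c +ℕ s) *ℕ k +ℕ s *ℕ tri k)) (invPoch s k) ⟩
    mono c ⊛ T' k
      ∎
    where
    exponent : ∀ c s k t → c *ℕ suc k +ℕ s *ℕ (t +ℕ k) ≡ c +ℕ ((c +ℕ s) *ℕ k +ℕ s *ℕ t)
    exponent = solveℕ

euler₂Series-rec : ∀ s c → 1 ≤ s → 1 ≤ c → euler₂Series s c ≈ onePlus c ⊛ euler₂Series s (c +ℕ s)
euler₂Series-rec s c s≥1 c≥1 = begin
  E
    ≈⟨ solve 3 (λ x y m → x := ((x :- y) :- m :* y) :+ (con 1ℤ :+ m) :* y) ≈-refl E E' (mono c) ⟩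
  ((E ⊝ E') ⊝ mono c ⊛ E') ⊕ onePlus c ⊛ E'
    ≈⟨ ⊕-cong (mk≈ (λ n → trans (cong (_- (mono c ⊛ E') n) (at (euler₂Series-⊝ s c s≥1 c≥1) n))
        (ZP.+-inverseʳ ((mono c ⊛ E') n)))) ≈-refl ⟩
  𝟘 ⊕ onePlus c ⊛ E'
    ≈⟨ mk≈ (λ n → ZP.+-identityˡ _) ⟩
  onePlus c ⊛ E'
    ∎
  where
  open ≈-Reasoning
  E E' : PS
  E = euler₂Series s c
  E' = euler₂Series s (c +ℕ s)

euler₂ : ∀ s c → 1 ≤ s → 1 ≤ c → euler₂Series s c ≈ qPochInfPlus c s
euler₂ s c s≥1 c≥1 =
  q-difference-unique s s≥1 (euler₂Series s) (λ c → qPochInfPlus c s) onePlus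
    (λ c c≥1 → euler₂Series-rec s c s≥1 c≥1)
    (λ c c≥1 → prodAP-front onePlus c s (ProdConvergent-onePlus c s c≥1 s≥1))
    (λ c c≥1 → ≡[]-trans (euler₂Series≡[]𝟙 s c c≥1) (≡[]-sym (prodAP≡[]𝟙 onePlus c s (λ a _ → onePlus≡[]𝟙 a))))
    c c≥1

-- A Durfee-type identity

durfeeTerm : ℕ → ℕ → ℕ → ℕ → PS
durfeeTerm s a n j = mono (s *ℕ (j *ℕ j +ℕ a *ℕ j)) ⊛ (invPoch s j ⊛ invPoch s (j +ℕ n))

durfeeSeries : ℕ → ℕ → ℕ → PS
durfeeSeries s a n = Σ∞ (durfeeTerm s a n)

SumConvergent-durfeeTerm : ∀ s a n → 1 ≤ s → SumConvergent (durfeeTerm s a n)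
SumConvergent-durfeeTerm s a n s≥1 j =
  O-mono-⊛-≤ (invPoch s j ⊛ invPoch s (j +ℕ n))
    (NP.≤-trans (k≤k*k j) (NP.≤-trans (NP.m≤m+n (j *ℕ j) (a *ℕ j)) (k≤c*k s _ s≥1)))

-- 1 / (q^s;q^s)_{j+n} = (1 - q^{s(j+n+1)}) / (q^s;q^s)_{j+n+1}
durfeeTerm-lowerʳ : ∀ s a n j → 1 ≤ s →
  durfeeTerm s a n j ≈ durfeeTerm s a (suc n) j ⊝ mono (s *ℕ suc n) ⊛ durfeeTerm s (suc a) (suc n) j
durfeeTerm-lowerʳ s a n j s≥1 = begin
  M ⊛ (P j ⊛ P (j +ℕ n))
    ≈⟨ ⊛-congʳ M (⊛-congʳ (P j) (≈-trans (≈-sym (oneMinus-⊛-invPoch s (j +ℕ n) s≥1))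
                                           (⊛-congʳ (oneMinus e) (≈-reflexive (cong (P) (sym (NP.+-suc j n))))))) ⟩
  M ⊛ (P j ⊛ (oneMinus e ⊛ P'))
    ≈⟨ solve 4 (λ m b p p' → m :* (p :* ((con 1ℤ :- b) :* p')) := m :* (p :* p') :- (m :* b) :* (p :* p')) ≈-refl M (mono e) (P j) P' ⟩
  M ⊛ (P j ⊛ P') ⊝ (M ⊛ mono e) ⊛ (P j ⊛ P')
    ≈⟨ ⊕-cong (≈-refl {M ⊛ (P j ⊛ P')})
         (⊖-cong (≈-trans (⊛-congˡ (≈-trans (mono-+ m₀ e) (mono-split (m₀ +ℕ e) (s *ℕ suc n) m₁ (exponent s a n j))) (P j ⊛ P'))
                                                         (⊛-assoc (mono (s *ℕ suc n)) (mono m₁) (P j ⊛ P')))) ⟩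
  durfeeTerm s a (suc n) j ⊝ mono (s *ℕ suc n) ⊛ durfeeTerm s (suc a) (suc n) j
    ∎
  where
  open ≈-Reasoning
  P : ℕ → PS
  P = invPoch s
  m₀ m₁ e : ℕ
  m₀ = s *ℕ (j *ℕ j +ℕ a *ℕ j)
  m₁ = s *ℕ (j *ℕ j +ℕ suc a *ℕ j)
  e = s *ℕ suc (j +ℕ n)
  M P' : PS
  M = mono m₀
  P' = P (j +ℕ suc n)
  exponent : ∀ s a n j → s *ℕ (j *ℕ j +ℕ a *ℕ j) +ℕ s *ℕ suc (j +ℕ n) ≡ s *ℕ suc n +ℕ s *ℕ (j *ℕ j +ℕ suc a *ℕ j)
  exponent = solveℕ

durfeeSeries-lowerʳ : ∀ s a n → 1 ≤ s →
  durfeeSeries s a n ≈ durfeeSeries s a (suc n) ⊝ mono (s *ℕ suc n) ⊛ durfeeSeries s (suc a) (suc n)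
durfeeSeries-lowerʳ s a n s≥1 = begin
  durfeeSeries s a n
    ≈⟨ Σ∞-cong (λ j → durfeeTerm-lowerʳ s a n j s≥1) ⟩
  Σ∞ (λ j → durfeeTerm s a (suc n) j ⊝ mono (s *ℕ suc n) ⊛ durfeeTerm s (suc a) (suc n) j)
    ≈⟨ Σ∞-⊝ (durfeeTerm s a (suc n)) (λ j → mono (s *ℕ suc n) ⊛ durfeeTerm s (suc a) (suc n) j) ⟩
  durfeeSeries s a (suc n) ⊝ Σ∞ (λ j → mono (s *ℕ suc n) ⊛ durfeeTerm s (suc a) (suc n) j)
    ≈⟨ ⊕-cong (≈-refl {durfeeSeries s a (suc n)})
              (⊖-cong (≈-sym (⊛-Σ∞ (mono (s *ℕ suc n)) (SumConvergent-durfeeTerm s (suc a) (suc n) s≥1)))) ⟩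
  durfeeSeries s a (suc n) ⊝ mono (s *ℕ suc n) ⊛ durfeeSeries s (suc a) (suc n)
    ∎
  where open ≈-Reasoning

-- (1 - q^{sj}) / (q^s;q^s)_j = 1 / (q^s;q^s)_{j-1}, which kills the term j = 0 and shifts the others.
durfeeSeries-lowerˡ : ∀ s a n → 1 ≤ s →
  durfeeSeries s a n ⊝ durfeeSeries s (suc a) n ≈ mono (s *ℕ suc a) ⊛ durfeeSeries s (suc (suc a)) (suc n)
durfeeSeries-lowerˡ s a n s≥1 = begin
  Σ∞ (durfeeTerm s a n) ⊝ Σ∞ (durfeeTerm s (suc a) n)
    ≈⟨ ≈-sym (Σ∞-⊝ (durfeeTerm s a n) (durfeeTerm s (suc a) n)) ⟩
  Σ∞ (λ j → durfeeTerm s a n j ⊝ durfeeTerm s (suc a) n j)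
    ≈⟨ Σ∞-cong term-⊝ ⟩
  Σ∞ gap
    ≈⟨ Σ∞-factor-front (mono (s *ℕ suc a)) cvGap (SumConvergent-durfeeTerm s (suc (suc a)) (suc n) s≥1) gap-zero gap-suc ⟩
  mono (s *ℕ suc a) ⊛ durfeeSeries s (suc (suc a)) (suc n)
    ∎
  where
  open ≈-Reasoning
  P : ℕ → PS
  P = invPoch s
  M : ℕ → PS
  M j = mono (s *ℕ (j *ℕ j +ℕ a *ℕ j))
  gap : ℕ → PS
  gap j = M j ⊛ ((oneMinus (s *ℕ j) ⊛ P j) ⊛ P (j +ℕ n))
  cvGap : SumConvergent gap
  cvGap j = O-resp-≈ (≈-sym (≈-trans (⊛-congʳ (M j) (⊛-assoc (oneMinus (s *ℕ j)) (P j) (P (j +ℕ n))))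
                                    (solve 3 (λ m o x → m :* (o :* x) := o :* (m :* x)) ≈-refl
                                       (M j) (oneMinus (s *ℕ j)) (P j ⊛ P (j +ℕ n)))))
                     (O-⊛ʳ j (oneMinus (s *ℕ j)) (M j ⊛ (P j ⊛ P (j +ℕ n))) (SumConvergent-durfeeTerm s a n s≥1 j))
  term-⊝ : ∀ j → durfeeTerm s a n j ⊝ durfeeTerm s (suc a) n j ≈ gap j
  term-⊝ j =
    ≈-trans (⊕-cong (≈-refl {durfeeTerm s a n j})
                    (⊖-cong (⊛-congˡ (mono-split (s *ℕ (j *ℕ j +ℕ suc a *ℕ j)) (s *ℕ (j *ℕ j +ℕ a *ℕ j)) (s *ℕ j) (exponent s a j))
                                     (P j ⊛ P (j +ℕ n)))))
      (solve 4 (λ m n p p' → m :* (p :* p') :- (m :* n) :* (p :* p') := m :* ((con 1ℤ :- n) :* p :* p')) ≈-refl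
         (M j) (mono (s *ℕ j)) (P j) (P (j +ℕ n)))
    where
    exponent : ∀ s a j → s *ℕ (j *ℕ j +ℕ suc a *ℕ j) ≡ s *ℕ (j *ℕ j +ℕ a *ℕ j) +ℕ s *ℕ j
    exponent = solveℕ
  gap-zero : gap 0 ≈ 𝟘
  gap-zero = ≈-trans (⊛-congʳ (M 0) (≈-trans (⊛-congˡ (oneMinus-*0-⊛ s (P 0)) (P n)) (𝟘-⊛ (P n)))) (⊛-𝟘 (M 0))
  gap-suc : ∀ i → gap (suc i) ≈ mono (s *ℕ suc a) ⊛ durfeeTerm s (suc (suc a)) (suc n) i
  gap-suc i =
    ≈-trans (⊛-cong (mono-split (s *ℕ (suc i *ℕ suc i +ℕ a *ℕ suc i)) (s *ℕ suc a) (s *ℕ (i *ℕ i +ℕ suc (suc a) *ℕ i))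
                                (exponent s a i))
                    (⊛-cong (oneMinus-⊛-invPoch s i s≥1) (≈-reflexive (cong P (sym (NP.+-suc i n))))))
            (⊛-assoc (mono (s *ℕ suc a)) (mono (s *ℕ (i *ℕ i +ℕ suc (suc a) *ℕ i))) (P i ⊛ P (i +ℕ suc n)))
    where
    exponent : ∀ s a i → s *ℕ (suc i *ℕ suc i +ℕ a *ℕ suc i) ≡ s *ℕ suc a +ℕ s *ℕ (i *ℕ i +ℕ suc (suc a) *ℕ i)
    exponent = solveℕ

durfeeSeries-diagonal-suc : ∀ s n → 1 ≤ s → durfeeSeries s n n ≈ durfeeSeries s (suc n) (suc n)
durfeeSeries-diagonal-suc s n s≥1 = begin
  D n n                        ≈⟨ solve 2 (λ d x → d := (d :- x) :+ x) ≈-refl (D n n) (D (suc n) n) ⟩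
  (D n n ⊝ D (suc n) n) ⊕ D (suc n) n
                               ≈⟨ ⊕-cong (durfeeSeries-lowerˡ s n n s≥1) (durfeeSeries-lowerʳ s (suc n) n s≥1) ⟩
  Y ⊕ (D (suc n) (suc n) ⊝ Y)  ≈⟨ solve 2 (λ y d → y :+ (d :- y) := d) ≈-refl Y (D (suc n) (suc n)) ⟩
  D (suc n) (suc n)            ∎
  where
  open ≈-Reasoning
  D : ℕ → ℕ → PS
  D = durfeeSeries s
  Y : PS
  Y = mono (s *ℕ suc n) ⊛ D (suc (suc n)) (suc n)

durfeeSeries≡[]invPoch : ∀ s N → 1 ≤ s → durfeeSeries s N N ≡[ s *ℕ suc N ] invPoch s N
durfeeSeries≡[]invPoch s N s≥1 = Σ∞≡[]head (s *ℕ suc N) (SumConvergent-durfeeTerm s N N s≥1) term₀ O-term-suc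
  where
  term₀ : durfeeTerm s N N 0 ≈ invPoch s N
  term₀ = ≈-trans (⊛-congˡ (≈-trans (mono-≡ (trans (cong (s *ℕ_) (NP.*-zeroʳ N)) (NP.*-zeroʳ s))) mono-zero) (𝟙 ⊛ invPoch s N))
                  (≈-trans (𝟙-⊛ (𝟙 ⊛ invPoch s N)) (𝟙-⊛ (invPoch s N)))
  O-term-suc : ∀ j → O (s *ℕ suc N) (durfeeTerm s N N (suc j))
  O-term-suc j = O-mono-⊛-≤ (invPoch s (suc j) ⊛ invPoch s (suc j +ℕ N))
                   (NP.*-monoʳ-≤ s (NP.+-mono-≤ (s≤s (z≤n {j +ℕ j *ℕ suc j})) (NP.m≤m*n N (suc j))))

invPoch≡[]qPochInfInv : ∀ s N → 1 ≤ s → invPoch s N ≡[ s *ℕ suc N ] qPochInfInv s s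
invPoch≡[]qPochInfInv s N s≥1 =
  ≡[]-sym (≡[]-trans (≈⇒≡[] (s *ℕ suc N) (infProd-split (ProdConvergent-inv1m s s s≥1 s≥1) N))
    (≡[]-⊛𝟙 (invPoch s N) (s *ℕ suc N) (infProd≡[]𝟙 (s *ℕ suc N) (λ k →
        ≡[]-weaken (s[1+N]≤ k) (inv1m≡[]𝟙 (s +ℕ s *ℕ (N +ℕ k)) (NP.≤-trans s≥1 (NP.m≤m+n s _)))))))
  where
  s[1+N]≤ : ∀ k → s *ℕ suc N ≤ s +ℕ s *ℕ (N +ℕ k)
  s[1+N]≤ k rewrite NP.*-suc s N = NP.+-monoʳ-≤ s (NP.*-monoʳ-≤ s (NP.m≤m+n N k))

-- The left side does not depend on n, and for large n it agrees with 1 / (q^s;q^s)_n to high order.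
durfee : ∀ s n → 1 ≤ s → durfeeSeries s n n ≈ qPochInfInv s s
durfee s n s≥1 = mk≈ λ m →
  trans (at (diagonal-shift m) m)
   (trans (durfeeSeries≡[]invPoch s (m +ℕ n) s≥1 m (m< m))
          (invPoch≡[]qPochInfInv s (m +ℕ n) s≥1 m (m< m)))
  where
  diagonal-shift : ∀ M → durfeeSeries s n n ≈ durfeeSeries s (M +ℕ n) (M +ℕ n)
  diagonal-shift zero    = ≈-refl
  diagonal-shift (suc M) = ≈-trans (diagonal-shift M) (durfeeSeries-diagonal-suc s (M +ℕ n) s≥1)
  m< : ∀ m → m < s *ℕ suc (m +ℕ n)
  m< m = NP.<-≤-trans (s≤s (NP.m≤m+n m n)) (NP.m≤n*m (suc (m +ℕ n)) s {{N.>-nonZero s≥1}})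

-- Jacobi's theta function and Gauss's identity

tri-double : ∀ x → x +ℕ 2 *ℕ tri x ≡ x *ℕ x
tri-double zero    = refl
tri-double (suc x) = trans (step₁ x (tri x)) (trans (cong (_+ℕ (2 *ℕ x +ℕ 1)) (tri-double x)) (step₂ x))
  where
  step₁ : ∀ x t → suc x +ℕ 2 *ℕ (t +ℕ x) ≡ (x +ℕ 2 *ℕ t) +ℕ (2 *ℕ x +ℕ 1)
  step₁ = solveℕ
  step₂ : ∀ x → x *ℕ x +ℕ (2 *ℕ x +ℕ 1) ≡ suc x *ℕ suc x
  step₂ = solveℕ

tri-+ : ∀ b n → tri (b +ℕ n) ≡ tri b +ℕ tri n +ℕ b *ℕ n
tri-+ b zero    rewrite NP.+-identityʳ b | NP.*-zeroʳ b = sym (trans (NP.+-identityʳ (tri b +ℕ 0)) (NP.+-identityʳ (tri b)))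
tri-+ b (suc n) rewrite NP.+-suc b n | tri-+ b n = regroup (tri b) (tri n) b n
  where
  regroup : ∀ tb tn b n → tb +ℕ tn +ℕ b *ℕ n +ℕ (b +ℕ n) ≡ tb +ℕ (tn +ℕ n) +ℕ b *ℕ suc n
  regroup = solveℕ

euler₂Pair : ℕ → ℕ → ℕ → ℕ → PS
euler₂Pair s c a b = euler₂Term s c a ⊛ euler₂Term s c b

SumConvergent₂-euler₂Pair : ∀ s c → 1 ≤ c → SumConvergent₂ (euler₂Pair s c)
SumConvergent₂-euler₂Pair s c c≥1 a b =
  O-⊛ˡ a (euler₂Term s c a) (euler₂Term s c b) (SumConvergent-euler₂Term s c c≥1 a) ,
  O-⊛ʳ b (euler₂Term s c a) (euler₂Term s c b) (SumConvergent-euler₂Term s c c≥1 b)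

-- Z (E² + Σ_b T_b²) = 2 Σ_n Z Σ_b T_{b+n} T_b for E = Σ_k T_k, with the inner sums evaluated as v n.
euler₂Series-square : ∀ s c Z (v : ℕ → PS) → 1 ≤ c → (∀ n → Z ⊛ diagonal (euler₂Pair s c) n ≈ v n) →
  Z ⊛ (euler₂Series s c ⊛ euler₂Series s c) ⊕ v 0 ≈ Σ∞ v ⊕ Σ∞ v
euler₂Series-square s c Z v c≥1 Z⊛R≈v = begin
  Z ⊛ (E ⊛ E) ⊕ v 0
    ≈⟨ ⊕-cong (≈-refl {Z ⊛ (E ⊛ E)}) (≈-sym (Z⊛R≈v 0)) ⟩
  Z ⊛ (E ⊛ E) ⊕ Z ⊛ R 0
    ≈⟨ ≈-sym (⊛-distribˡ (E ⊛ E) (R 0) Z) ⟩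
  Z ⊛ (E ⊛ E ⊕ R 0)
    ≈⟨ ⊛-congʳ Z (⊕-cong (Σ∞-⊛-Σ∞ cvT cvT)
                         (Σ∞-cong (λ b → ≈-reflexive (cong (λ x → euler₂Pair s c x b) (NP.+-identityʳ b))))) ⟩
  Z ⊛ (Σ∞₂ (euler₂Pair s c) ⊕ Σ∞ (λ b → euler₂Pair s c b b))
    ≈⟨ ⊛-congʳ Z (Σ∞₂-symmetric-diagonals (euler₂Pair s c) (SumConvergent₂-euler₂Pair s c c≥1)
        (λ a b → ⊛-comm (euler₂Term s c a) (euler₂Term s c b))) ⟩
  Z ⊛ (Σ∞ R ⊕ Σ∞ R)
    ≈⟨ ⊛-distribˡ (Σ∞ R) (Σ∞ R) Z ⟩
  Z ⊛ Σ∞ R ⊕ Z ⊛ Σ∞ R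
    ≈⟨ ⊕-cong Z⊛ΣR≈Σv Z⊛ΣR≈Σv ⟩
  Σ∞ v ⊕ Σ∞ v
    ∎
  where
  open ≈-Reasoning
  E : PS
  E = euler₂Series s c
  R : ℕ → PS
  R = diagonal (euler₂Pair s c)
  cvT : SumConvergent (euler₂Term s c)
  cvT = SumConvergent-euler₂Term s c c≥1
  cvR : SumConvergent R
  cvR n = O-Σ∞ n (λ b → O-weaken (NP.m≤n+m n b) (proj₁ (SumConvergent₂-euler₂Pair s c c≥1 (b +ℕ n) b)))
  Z⊛ΣR≈Σv : Z ⊛ Σ∞ R ≈ Σ∞ v
  Z⊛ΣR≈Σv = ≈-trans (⊛-Σ∞ Z cvR) (Σ∞-cong Z⊛R≈v)

Θ : PS
Θ = Σ∞ (λ n → mono (n *ℕ n))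

euler₂Pair-theta : ∀ n b → euler₂Pair 2 1 (b +ℕ n) b ≈ mono (n *ℕ n) ⊛ durfeeTerm 2 n n b
euler₂Pair-theta n b = begin
  (mono e₁ ⊛ invPoch 2 (b +ℕ n)) ⊛ (mono e₂ ⊛ invPoch 2 b)
    ≈⟨ solve 4 (λ m p m' p' → (m :* p) :* (m' :* p') := (m :* m') :* (p' :* p)) ≈-refl
         (mono e₁) (invPoch 2 (b +ℕ n)) (mono e₂) (invPoch 2 b) ⟩
  (mono e₁ ⊛ mono e₂) ⊛ (invPoch 2 b ⊛ invPoch 2 (b +ℕ n))
    ≈⟨ ⊛-congˡ (≈-trans (mono-+ e₁ e₂) (mono-split (e₁ +ℕ e₂) (n *ℕ n) (2 *ℕ (b *ℕ b +ℕ n *ℕ b)) exponent))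
                 (invPoch 2 b ⊛ invPoch 2 (b +ℕ n)) ⟩
  (mono (n *ℕ n) ⊛ mono (2 *ℕ (b *ℕ b +ℕ n *ℕ b))) ⊛ (invPoch 2 b ⊛ invPoch 2 (b +ℕ n))
    ≈⟨ ⊛-assoc (mono (n *ℕ n)) (mono (2 *ℕ (b *ℕ b +ℕ n *ℕ b))) (invPoch 2 b ⊛ invPoch 2 (b +ℕ n)) ⟩
  mono (n *ℕ n) ⊛ durfeeTerm 2 n n b
    ∎
  where
  open ≈-Reasoning
  e₁ e₂ : ℕ
  e₁ = 1 *ℕ (b +ℕ n) +ℕ 2 *ℕ tri (b +ℕ n)
  e₂ = 1 *ℕ b +ℕ 2 *ℕ tri b
  squares : ∀ b n → (b +ℕ n) *ℕ (b +ℕ n) +ℕ b *ℕ b ≡ n *ℕ n +ℕ 2 *ℕ (b *ℕ b +ℕ n *ℕ b)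
  squares = solveℕ
  exponent : e₁ +ℕ e₂ ≡ n *ℕ n +ℕ 2 *ℕ (b *ℕ b +ℕ n *ℕ b)
  exponent = trans (cong₂ _+ℕ_ (trans (cong (_+ℕ 2 *ℕ tri (b +ℕ n)) (NP.*-identityˡ (b +ℕ n))) (tri-double (b +ℕ n)))
                               (trans (cong (_+ℕ 2 *ℕ tri b) (NP.*-identityˡ b)) (tri-double b)))
                   (squares b n)

theta : qPochInf 2 2 ⊛ (euler₂Series 2 1 ⊛ euler₂Series 2 1) ⊕ 𝟙 ≈ Θ ⊕ Θ
theta = ≈-trans (⊕-cong (≈-refl {qPochInf 2 2 ⊛ (euler₂Series 2 1 ⊛ euler₂Series 2 1)}) (≈-sym mono-zero))
                (euler₂Series-square 2 1 Z (λ n → mono (n *ℕ n)) (s≤s z≤n) Z⊛diagonal)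
  where
  Z : PS
  Z = qPochInf 2 2
  Z⊛diagonal : ∀ n → Z ⊛ diagonal (euler₂Pair 2 1) n ≈ mono (n *ℕ n)
  Z⊛diagonal n = begin
    Z ⊛ diagonal (euler₂Pair 2 1) n
      ≈⟨ ⊛-congʳ Z (Σ∞-cong (euler₂Pair-theta n)) ⟩
    Z ⊛ Σ∞ (λ b → mono (n *ℕ n) ⊛ durfeeTerm 2 n n b)
      ≈⟨ ⊛-congʳ Z (≈-sym (⊛-Σ∞ (mono (n *ℕ n)) (SumConvergent-durfeeTerm 2 n n (s≤s z≤n)))) ⟩
    Z ⊛ (mono (n *ℕ n) ⊛ durfeeSeries 2 n n)
      ≈⟨ ⊛-congʳ Z (⊛-congʳ (mono (n *ℕ n)) (durfee 2 n (s≤s z≤n))) ⟩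
    Z ⊛ (mono (n *ℕ n) ⊛ qPochInfInv 2 2)
      ≈⟨ solve 3 (λ z m i → z :* (m :* i) := m :* (z :* i)) ≈-refl Z (mono (n *ℕ n)) (qPochInfInv 2 2) ⟩
    mono (n *ℕ n) ⊛ (Z ⊛ qPochInfInv 2 2)
      ≈⟨ ⊛-congʳ (mono (n *ℕ n)) (qPochInf-⊛-qPochInfInv 2 2 (s≤s z≤n) (s≤s z≤n)) ⟩
    mono (n *ℕ n) ⊛ 𝟙
      ≈⟨ ⊛-𝟙 (mono (n *ℕ n)) ⟩
    mono (n *ℕ n)
      ∎
    where open ≈-Reasoning

⊕-cancelʳ : ∀ X Y A → X ⊕ A ≈ Y ⊕ A → X ≈ Y
⊕-cancelʳ X Y A e = mk≈ λ n → trans (add-sub (X n) (A n)) (trans (cong (_- A n) (at e n)) (sym (add-sub (Y n) (A n))))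
  where
  add-sub : ∀ x a → x ≡ (x + a) - a
  add-sub = solve-∀

Σ∞-telescope : ∀ {u a} → SumConvergent u → SumConvergent a → (∀ n → u n ≈ a n ⊝ u (suc n)) →
  Σ∞ u ⊕ Σ∞ u ≈ Σ∞ a ⊕ u 0
Σ∞-telescope {u} {a} cvu cva u-rec = begin
  Σ∞ u ⊕ Σ∞ u
    ≈⟨ ⊕-cong (Σ∞-front cvu) (Σ∞-cong u-rec) ⟩
  (u 0 ⊕ Σ∞ (λ n → u (suc n))) ⊕ Σ∞ (λ n → a n ⊝ u (suc n))
    ≈⟨ ⊕-cong (≈-refl {u 0 ⊕ Σ∞ (λ n → u (suc n))}) (Σ∞-⊝ a (λ n → u (suc n))) ⟩
  (u 0 ⊕ Σ∞ (λ n → u (suc n))) ⊕ (Σ∞ a ⊝ Σ∞ (λ n → u (suc n)))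
    ≈⟨ solve 3 (λ x y z → (x :+ y) :+ (z :- y) := z :+ x) ≈-refl (u 0) (Σ∞ (λ n → u (suc n))) (Σ∞ a) ⟩
  Σ∞ a ⊕ u 0
    ∎
  where open ≈-Reasoning

ψ : ℕ → PS
ψ s = Σ∞ (λ n → mono (s *ℕ tri (suc n)))

euler₂Pair-gauss : ∀ s n b → euler₂Pair s s (b +ℕ n) b ≈ mono (s *ℕ tri (suc n)) ⊛ durfeeTerm s (suc n) n b
euler₂Pair-gauss s n b = begin
  (mono e₁ ⊛ invPoch s (b +ℕ n)) ⊛ (mono e₂ ⊛ invPoch s b)
    ≈⟨ solve 4 (λ m p m' p' → (m :* p) :* (m' :* p') := (m :* m') :* (p' :* p)) ≈-refl
         (mono e₁) (invPoch s (b +ℕ n)) (mono e₂) (invPoch s b) ⟩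
  (mono e₁ ⊛ mono e₂) ⊛ (invPoch s b ⊛ invPoch s (b +ℕ n))
    ≈⟨ ⊛-congˡ (≈-trans (mono-+ e₁ e₂) (mono-split (e₁ +ℕ e₂) (s *ℕ tri (suc n)) e₃ exponent))
               (invPoch s b ⊛ invPoch s (b +ℕ n)) ⟩
  (mono (s *ℕ tri (suc n)) ⊛ mono e₃) ⊛ (invPoch s b ⊛ invPoch s (b +ℕ n))
    ≈⟨ ⊛-assoc (mono (s *ℕ tri (suc n))) (mono e₃) (invPoch s b ⊛ invPoch s (b +ℕ n)) ⟩
  mono (s *ℕ tri (suc n)) ⊛ durfeeTerm s (suc n) n b
    ∎
  where
  open ≈-Reasoning
  e₁ e₂ e₃ : ℕ
  e₁ = s *ℕ (b +ℕ n) +ℕ s *ℕ tri (b +ℕ n)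
  e₂ = s *ℕ b +ℕ s *ℕ tri b
  e₃ = s *ℕ (b *ℕ b +ℕ suc n *ℕ b)
  exponent : e₁ +ℕ e₂ ≡ s *ℕ tri (suc n) +ℕ e₃
  exponent rewrite tri-+ b n | sym (tri-double b) = regroup s b n (tri b) (tri n)
    where
    regroup : ∀ s b n tb tn → s *ℕ (b +ℕ n) +ℕ s *ℕ (tb +ℕ tn +ℕ b *ℕ n) +ℕ (s *ℕ b +ℕ s *ℕ tb)
                              ≡ s *ℕ (tn +ℕ n) +ℕ s *ℕ ((b +ℕ 2 *ℕ tb) +ℕ suc n *ℕ b)
    regroup = solveℕ

gaussWeight : ℕ → ℕ → PS
gaussWeight s n = qPochInf s s ⊛ durfeeSeries s (suc n) n

gaussWeight-rec : ∀ s n → 1 ≤ s → gaussWeight s n ≈ 𝟙 ⊝ mono (s *ℕ suc n) ⊛ gaussWeight s (suc n)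
gaussWeight-rec s n s≥1 = begin
  Z ⊛ durfeeSeries s (suc n) n
    ≈⟨ ⊛-congʳ Z (durfeeSeries-lowerʳ s (suc n) n s≥1) ⟩
  Z ⊛ (durfeeSeries s (suc n) (suc n) ⊝ m ⊛ durfeeSeries s (suc (suc n)) (suc n))
    ≈⟨ solve 4 (λ z e m f → z :* (e :- m :* f) := z :* e :- m :* (z :* f)) ≈-refl
         Z (durfeeSeries s (suc n) (suc n)) m (durfeeSeries s (suc (suc n)) (suc n)) ⟩
  Z ⊛ durfeeSeries s (suc n) (suc n) ⊝ m ⊛ gaussWeight s (suc n)
    ≈⟨ ⊕-cong (≈-trans (⊛-congʳ Z (durfee s (suc n) s≥1)) (qPochInf-⊛-qPochInfInv s s s≥1 s≥1))
              (≈-refl {⊖ (m ⊛ gaussWeight s (suc n))}) ⟩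
  𝟙 ⊝ m ⊛ gaussWeight s (suc n)
    ∎
  where
  open ≈-Reasoning
  Z m : PS
  Z = qPochInf s s
  m = mono (s *ℕ suc n)

qPochInf-⊛-diagonal-gauss : ∀ s n → 1 ≤ s →
  qPochInf s s ⊛ diagonal (euler₂Pair s s) n ≈ mono (s *ℕ tri (suc n)) ⊛ gaussWeight s n
qPochInf-⊛-diagonal-gauss s n s≥1 = begin
  Z ⊛ diagonal (euler₂Pair s s) n
    ≈⟨ ⊛-congʳ Z (Σ∞-cong (euler₂Pair-gauss s n)) ⟩
  Z ⊛ Σ∞ (λ b → t ⊛ durfeeTerm s (suc n) n b)
    ≈⟨ ⊛-congʳ Z (≈-sym (⊛-Σ∞ t (SumConvergent-durfeeTerm s (suc n) n s≥1))) ⟩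
  Z ⊛ (t ⊛ durfeeSeries s (suc n) n)
    ≈⟨ solve 3 (λ z m e → z :* (m :* e) := m :* (z :* e)) ≈-refl Z t (durfeeSeries s (suc n) n) ⟩
  t ⊛ gaussWeight s n
    ∎
  where
  open ≈-Reasoning
  Z t : PS
  Z = qPochInf s s
  t = mono (s *ℕ tri (suc n))

gauss : ∀ s → 1 ≤ s → qPochInf s s ⊛ (euler₂Series s s ⊛ euler₂Series s s) ≈ ψ s
gauss s s≥1 = ⊕-cancelʳ (qPochInf s s ⊛ (euler₂Series s s ⊛ euler₂Series s s)) (ψ s) (u 0)
  (≈-trans (euler₂Series-square s s (qPochInf s s) u s≥1 (λ n → qPochInf-⊛-diagonal-gauss s n s≥1))
           (Σ∞-telescope cvu cvt u-rec))
  where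
  t u : ℕ → PS
  t n = mono (s *ℕ tri (suc n))
  u n = t n ⊛ gaussWeight s n
  u-rec : ∀ n → u n ≈ t n ⊝ u (suc n)
  u-rec n = begin
    t n ⊛ W
      ≈⟨ ⊛-congʳ (t n) (gaussWeight-rec s n s≥1) ⟩
    t n ⊛ (𝟙 ⊝ m ⊛ W′)
      ≈⟨ solve 3 (λ a m w → a :* (con 1ℤ :- m :* w) := a :- (a :* m) :* w) ≈-refl (t n) m W′ ⟩
    t n ⊝ (t n ⊛ m) ⊛ W′
      ≈⟨ ⊕-cong (≈-refl {t n}) (⊖-cong (⊛-congˡ t⊛m≈t W′)) ⟩
    t n ⊝ u (suc n)
      ∎
    where
    open ≈-Reasoning
    m W W′ : PS
    m = mono (s *ℕ suc n)
    W = gaussWeight s n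
    W′ = gaussWeight s (suc n)
    t⊛m≈t : t n ⊛ m ≈ t (suc n)
    t⊛m≈t = ≈-trans (mono-+ (s *ℕ tri (suc n)) (s *ℕ suc n)) (mono-≡ (sym (NP.*-distribˡ-+ s (tri (suc n)) (suc n))))
  n≤ : ∀ n → n ≤ s *ℕ tri (suc n)
  n≤ n = NP.≤-trans (NP.m≤n+m n (tri n)) (k≤c*k s (tri (suc n)) s≥1)
  cvu : SumConvergent u
  cvu n = O-mono-⊛-≤ (gaussWeight s n) (n≤ n)
  cvt : SumConvergent t
  cvt n = O-weaken (n≤ n) (O-mono (s *ℕ tri (suc n)))

-- The substitution q ↦ q² and odd parts

dilate : PS → PS
dilate f zero          = f 0
dilate f (suc zero)    = 0ℤ
dilate f (suc (suc n)) = dilate (tail f) n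

data Parity : ℕ → Set where
  even : ∀ k → Parity (k +ℕ k)
  odd  : ∀ k → Parity (suc (k +ℕ k))

parity : ∀ n → Parity n
parity zero = even 0
parity (suc n) with parity n
... | even k = odd k
... | odd k  = subst Parity (cong suc (NP.+-suc k k)) (even (suc k))

dilate-even : ∀ f k → dilate f (k +ℕ k) ≡ f k
dilate-even f zero    = refl
dilate-even f (suc k) rewrite NP.+-suc k k = dilate-even (tail f) k

dilate-odd : ∀ f k → dilate f (suc (k +ℕ k)) ≡ 0ℤ
dilate-odd f zero    = refl
dilate-odd f (suc k) rewrite NP.+-suc k k = dilate-odd (tail f) k

dilate-unique : ∀ f g → (∀ k → g (k +ℕ k) ≡ f k) → (∀ k → g (suc (k +ℕ k)) ≡ 0ℤ) → dilate f ≈ g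
dilate-unique f g g-even g-odd = mk≈ coeff
  where
  coeff : ∀ n → dilate f n ≡ g n
  coeff n with parity n
  ... | even k = trans (dilate-even f k) (sym (g-even k))
  ... | odd k  = trans (dilate-odd f k) (sym (g-odd k))

dilate-cong : ∀ {f g} → f ≈ g → dilate f ≈ dilate g
dilate-cong {f} {g} e = dilate-unique f (dilate g) (λ k → trans (dilate-even g k) (sym (at e k))) (dilate-odd g)

dilate-⊕ : ∀ f g → dilate (f ⊕ g) ≈ dilate f ⊕ dilate g
dilate-⊕ f g = dilate-unique (f ⊕ g) (dilate f ⊕ dilate g)
  (λ k → cong₂ _+_ (dilate-even f k) (dilate-even g k)) (λ k → cong₂ _+_ (dilate-odd f k) (dilate-odd g k))

dilate-⊖ : ∀ f → dilate (⊖ f) ≈ ⊖ dilate f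
dilate-⊖ f = dilate-unique (⊖ f) (⊖ dilate f) (λ k → cong -_ (dilate-even f k)) (λ k → cong -_ (dilate-odd f k))

dilate-· : ∀ a f → dilate (a · f) ≈ a · dilate f
dilate-· a f = dilate-unique (a · f) (a · dilate f)
  (λ k → cong (a *_) (dilate-even f k)) (λ k → trans (cong (a *_) (dilate-odd f k)) (ZP.*-zeroʳ a))

dilate-⊛-at : ∀ n f g → (dilate f ⊛ dilate g) n ≡ dilate (f ⊛ g) n
dilate-⊛-at zero f g = trans (⊛-zero-at (dilate f) (dilate g)) (sym (⊛-zero-at f g))
dilate-⊛-at (suc zero) f g = vanish (f 0) (g 0)
  where
  vanish : ∀ a b → 0ℤ + a * 0ℤ + 0ℤ * b ≡ 0ℤ
  vanish a b rewrite ZP.*-zeroʳ a = refl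
dilate-⊛-at (suc (suc n)) f g = begin
  (dilate f ⊛ dilate g) (suc (suc n))
    ≡⟨ ⊛-suc-at (dilate f) (dilate g) (suc n) ⟩
  f 0 * dilate (tail g) n + (tail (dilate f) ⊛ dilate g) (suc n)
    ≡⟨ cong (f 0 * dilate (tail g) n +_) (⊛-suc-at (tail (dilate f)) (dilate g) n) ⟩
  f 0 * dilate (tail g) n + (0ℤ * dilate g (suc n) + (dilate (tail f) ⊛ dilate g) n)
    ≡⟨ cong (λ x → f 0 * dilate (tail g) n + (0ℤ + x)) (dilate-⊛-at n (tail f) g) ⟩
  f 0 * dilate (tail g) n + (0ℤ + dilate (tail f ⊛ g) n)
    ≡⟨ cong₂ _+_ (sym (at (dilate-· (f 0) (tail g)) n)) (ZP.+-identityˡ _) ⟩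
  dilate (f 0 · tail g) n + dilate (tail f ⊛ g) n
    ≡⟨ sym (at (dilate-⊕ (f 0 · tail g) (tail f ⊛ g)) n) ⟩
  dilate (f 0 · tail g ⊕ tail f ⊛ g) n
    ≡⟨ at (dilate-cong (mk≈ (λ m → sym (⊛-suc-at f g m)))) n ⟩
  dilate (tail (f ⊛ g)) n
    ∎
  where open ≡-Reasoning

dilate-⊛ : ∀ f g → dilate (f ⊛ g) ≈ dilate f ⊛ dilate g
dilate-⊛ f g = mk≈ (λ n → sym (dilate-⊛-at n f g))

dilate-mono : ∀ m → dilate (mono m) ≈ mono (m +ℕ m)
dilate-mono m = dilate-unique (mono m) (mono (m +ℕ m))
  (λ k → cong (λ b → if b then 1ℤ else 0ℤ) (double-≡ᵇ-double m k))
  (λ k → cong (λ b → if b then 1ℤ else 0ℤ) (double-≡ᵇ-odd m k))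
  where
  double-≡ᵇ-double : ∀ m k → (m +ℕ m ≡ᵇ k +ℕ k) ≡ (m ≡ᵇ k)
  double-≡ᵇ-double zero    zero    = refl
  double-≡ᵇ-double zero    (suc k) = refl
  double-≡ᵇ-double (suc m) zero    = refl
  double-≡ᵇ-double (suc m) (suc k) rewrite NP.+-suc m m | NP.+-suc k k = double-≡ᵇ-double m k
  double-≡ᵇ-odd : ∀ m k → (m +ℕ m ≡ᵇ suc (k +ℕ k)) ≡ false
  double-≡ᵇ-odd zero    k       = refl
  double-≡ᵇ-odd (suc m) zero    rewrite NP.+-suc m m = refl
  double-≡ᵇ-odd (suc m) (suc k) rewrite NP.+-suc m m | NP.+-suc k k = double-≡ᵇ-odd m k

dilate-𝟙 : dilate 𝟙 ≈ 𝟙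
dilate-𝟙 = ≈-trans (dilate-cong (≈-sym mono-zero)) (≈-trans (dilate-mono 0) mono-zero)

dilate-oneMinus : ∀ m → dilate (oneMinus m) ≈ oneMinus (m +ℕ m)
dilate-oneMinus m = ≈-trans (dilate-⊕ 𝟙 (⊖ mono m)) (⊕-cong dilate-𝟙 (≈-trans (dilate-⊖ (mono m)) (⊖-cong (dilate-mono m))))

dilate-inv1m : ∀ c → 1 ≤ c → dilate (inv1m c) ≈ inv1m (c +ℕ c)
dilate-inv1m c c≥1 = inverse-unique (dilate (inv1m c)) (inv1m (c +ℕ c)) (oneMinus (c +ℕ c))
  (begin
    dilate (inv1m c) ⊛ oneMinus (c +ℕ c)        ≈⟨ ⊛-congʳ (dilate (inv1m c)) (≈-sym (dilate-oneMinus c)) ⟩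
    dilate (inv1m c) ⊛ dilate (oneMinus c)      ≈⟨ ≈-sym (dilate-⊛ (inv1m c) (oneMinus c)) ⟩
    dilate (inv1m c ⊛ oneMinus c)               ≈⟨ dilate-cong (inv1m-⊛-oneMinus c c≥1) ⟩
    dilate 𝟙                                    ≈⟨ dilate-𝟙 ⟩
    𝟙                                           ∎)
  (inv1m-⊛-oneMinus (c +ℕ c) (NP.≤-trans c≥1 (NP.m≤m+n c c)))
  where open ≈-Reasoning

dilate-prodTo : ∀ m F → dilate (prodTo m F) ≈ prodTo m (λ k → dilate (F k))
dilate-prodTo zero    F = dilate-𝟙
dilate-prodTo (suc m) F = ≈-trans (dilate-⊛ (prodTo m F) (F m)) (⊛-congˡ (dilate-prodTo m F) (dilate (F m)))

dilate-≡[] : ∀ {f g} N → f ≡[ N ] g → dilate f ≡[ N +ℕ N ] dilate g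
dilate-≡[] {f} {g} N e n p with parity n
... | even k = trans (dilate-even f k) (trans (e k (k<N p)) (sym (dilate-even g k)))
  where
  k<N : ∀ {k N} → k +ℕ k < N +ℕ N → k < N
  k<N {k} {N} p with k N.<? N
  ... | yes q = q
  ... | no q  = ⊥-elim (NP.<⇒≱ p (NP.+-mono-≤ (NP.≮⇒≥ q) (NP.≮⇒≥ q)))
... | odd k  = trans (dilate-odd f k) (sym (dilate-odd g k))

O-dilate : ∀ {f} k → O k f → O k (dilate f)
O-dilate {f} k o n p with parity n
... | even j = trans (dilate-even f j) (o j (NP.≤-<-trans (NP.m≤m+n j j) p))
... | odd j  = dilate-odd f j

dilate-infProd : ∀ {F} → ProdConvergent F → dilate (infProd F) ≈ infProd (λ k → dilate (F k))
dilate-infProd {F} cv = mk≈ λ n →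
  trans (dilate-≡[] (suc n) (infProd≡[]prodTo cv (suc n)) n (NP.≤-trans (NP.n<1+n n) (NP.m≤m+n (suc n) (suc n))))
        (at (dilate-prodTo (suc n) F) n)

dilate-Σ∞ : ∀ {c} → SumConvergent c → dilate (Σ∞ c) ≈ Σ∞ (λ k → dilate (c k))
dilate-Σ∞ {c} cv = dilate-unique (Σ∞ c) (Σ∞ (λ k → dilate (c k)))
  (λ j → trans (sumTo-cong (suc (j +ℕ j)) (λ k → dilate-even (c k) j))
               (sym (Σ∞≡sumTo cv j (suc (j +ℕ j)) (s≤s (NP.m≤m+n j j)))))
  (λ j → sumTo-zero (suc (suc (j +ℕ j))) (λ k _ → dilate-odd (c k) j))

dilate-Σ∞₂ : ∀ c → SumConvergent₂ c → dilate (Σ∞₂ c) ≈ Σ∞₂ (λ i j → dilate (c i j))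
dilate-Σ∞₂ c cv =
  ≈-trans (dilate-Σ∞ {λ i → Σ∞ (c i)} (λ i → O-Σ∞ i (λ j → proj₁ (cv i j))))
          (Σ∞-cong (λ i → dilate-Σ∞ {c i} (λ j → proj₂ (cv i j))))

oddPart : PS → PS
oddPart f k = f (suc (k +ℕ k))

oddPart-cong : ∀ {f g} → f ≈ g → oddPart f ≈ oddPart g
oddPart-cong e = mk≈ (λ k → at e (suc (k +ℕ k)))

oddPart-dilate : ∀ a b → oddPart (dilate a ⊕ mono 1 ⊛ dilate b) ≈ b
oddPart-dilate a b = mk≈ λ k →
  trans (cong₂ _+_ (dilate-odd a k) (mono-⊛-at 1 (dilate b) (k +ℕ k))) (trans (ZP.+-identityˡ _) (dilate-even b k))

FTerm : ℕ → ℕ → PS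
FTerm m k = mono (2 *ℕ m *ℕ k +ℕ m +ℕ k) ⊛ (invPoch 2 m ⊛ invPoch 2 k)

F : PS
F = Σ∞₂ FTerm

SumConvergent₂-FTerm : SumConvergent₂ FTerm
SumConvergent₂-FTerm m k =
  O-mono-⊛-≤ (invPoch 2 m ⊛ invPoch 2 k) (NP.≤-trans (NP.m≤n+m m (2 *ℕ m *ℕ k)) (NP.m≤m+n _ k)) ,
  O-mono-⊛-≤ (invPoch 2 m ⊛ invPoch 2 k) (NP.m≤n+m k (2 *ℕ m *ℕ k +ℕ m))

SumConvergent-ΣFTerm : SumConvergent (λ m → Σ∞ (FTerm m))
SumConvergent-ΣFTerm m = O-Σ∞ m (λ k → proj₁ (SumConvergent₂-FTerm m k))

Σ∞-FTerm : ∀ m → Σ∞ (FTerm m) ≈ (mono m ⊛ invPoch 2 m) ⊛ qPochInfInv (1 +ℕ 2 *ℕ m) 2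
Σ∞-FTerm m = begin
  Σ∞ (FTerm m)
    ≈⟨ Σ∞-cong term ⟩
  Σ∞ (λ k → X ⊛ qBinomialTerm 2 𝟘 c k)
    ≈⟨ ≈-sym (⊛-Σ∞ X (SumConvergent-qBinomialTerm 2 𝟘 c (s≤s z≤n))) ⟩
  X ⊛ qBinomialSeries 2 𝟘 c
    ≈⟨ ⊛-congʳ X (euler₁ 2 c (s≤s z≤n) (s≤s z≤n)) ⟩
  X ⊛ qPochInfInv c 2
    ∎
  where
  open ≈-Reasoning
  c : ℕ
  c = 1 +ℕ 2 *ℕ m
  X : PS
  X = mono m ⊛ invPoch 2 m
  exponent : ∀ m k → 2 *ℕ m *ℕ k +ℕ m +ℕ k ≡ m +ℕ (1 +ℕ 2 *ℕ m) *ℕ k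
  exponent = solveℕ
  term : ∀ k → FTerm m k ≈ X ⊛ qBinomialTerm 2 𝟘 c k
  term k = begin
    FTerm m k
      ≈⟨ ⊛-congˡ (mono-split _ m (c *ℕ k) (exponent m k)) (invPoch 2 m ⊛ invPoch 2 k) ⟩
    (mono m ⊛ mono (c *ℕ k)) ⊛ (invPoch 2 m ⊛ invPoch 2 k)
      ≈⟨ solve 4 (λ a b p q → (a :* b) :* (p :* q) := (a :* p) :* (b :* q)) ≈-refl (mono m) (mono (c *ℕ k)) (invPoch 2 m) (invPoch 2 k) ⟩
    X ⊛ (mono (c *ℕ k) ⊛ invPoch 2 k)
      ≈⟨ ⊛-congʳ X (≈-sym (≈-trans (⊛-congˡ (poch-𝟘 2 k) (mono (c *ℕ k) ⊛ invPoch 2 k))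
                                   (𝟙-⊛ (mono (c *ℕ k) ⊛ invPoch 2 k)))) ⟩
    X ⊛ qBinomialTerm 2 𝟘 c k
      ∎

qPochInf-⊛-qPochInfInv-tail : ∀ a d m → 1 ≤ a → 1 ≤ d → qPochInf a d ⊛ qPochInfInv (a +ℕ d *ℕ m) d ≈ qPochFin a d m
qPochInf-⊛-qPochInfInv-tail a d m a≥1 d≥1 = begin
  qPochInf a d ⊛ I
    ≈⟨ ⊛-congˡ (infProd-split (ProdConvergent-oneMinus a d a≥1 d≥1) m) I ⟩
  (qPochFin a d m ⊛ infProd (λ k → oneMinus (a +ℕ d *ℕ (m +ℕ k)))) ⊛ I
    ≈⟨ ⊛-congˡ (⊛-congʳ (qPochFin a d m) (infProd-cong (λ k → oneMinus-≡ (distrib a d m k)))) I ⟩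
  (qPochFin a d m ⊛ qPochInf (a +ℕ d *ℕ m) d) ⊛ I
    ≈⟨ ⊛-assoc (qPochFin a d m) (qPochInf (a +ℕ d *ℕ m) d) I ⟩
  qPochFin a d m ⊛ (qPochInf (a +ℕ d *ℕ m) d ⊛ I)
    ≈⟨ ⊛-congʳ (qPochFin a d m) (qPochInf-⊛-qPochInfInv (a +ℕ d *ℕ m) d (NP.≤-trans a≥1 (NP.m≤m+n a _)) d≥1) ⟩
  qPochFin a d m ⊛ 𝟙
    ≈⟨ ⊛-𝟙 (qPochFin a d m) ⟩
  qPochFin a d m
    ∎
  where
  open ≈-Reasoning
  I : PS
  I = qPochInfInv (a +ℕ d *ℕ m) d
  distrib : ∀ a d m k → a +ℕ d *ℕ (m +ℕ k) ≡ (a +ℕ d *ℕ m) +ℕ d *ℕ k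
  distrib = solveℕ

-- Summing over k by Euler's identity and then over m by the q-binomial theorem.
qPochInf-⊛-F : qPochInf 1 2 ⊛ F ≈ qPochInf 2 2 ⊛ qPochInfInv 1 2
qPochInf-⊛-F = begin
  A ⊛ F                                        ≈⟨ ⊛-Σ∞ A SumConvergent-ΣFTerm ⟩
  Σ∞ (λ m → A ⊛ Σ∞ (FTerm m))                  ≈⟨ Σ∞-cong term ⟩
  qBinomialSeries 2 (mono 1) 1                 ≈⟨ q-binomial 2 1 1 (s≤s z≤n) (s≤s z≤n) ⟩
  qPochInf 2 2 ⊛ qPochInfInv 1 2               ∎
  where
  open ≈-Reasoning
  A : PS
  A = qPochInf 1 2
  term : ∀ m → A ⊛ Σ∞ (FTerm m) ≈ qBinomialTerm 2 (mono 1) 1 m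
  term m = begin
    A ⊛ Σ∞ (FTerm m)
      ≈⟨ ⊛-congʳ A (Σ∞-FTerm m) ⟩
    A ⊛ ((mono m ⊛ invPoch 2 m) ⊛ qPochInfInv (1 +ℕ 2 *ℕ m) 2)
      ≈⟨ solve 4 (λ a x p i → a :* ((x :* p) :* i) := (a :* i) :* (x :* p)) ≈-refl
           A (mono m) (invPoch 2 m) (qPochInfInv (1 +ℕ 2 *ℕ m) 2) ⟩
    (A ⊛ qPochInfInv (1 +ℕ 2 *ℕ m) 2) ⊛ (mono m ⊛ invPoch 2 m)
      ≈⟨ ⊛-cong (≈-trans (qPochInf-⊛-qPochInfInv-tail 1 2 m (s≤s z≤n) (s≤s z≤n)) (≈-sym (poch-mono 2 1 m)))
                (⊛-congˡ (mono-≡ (sym (NP.*-identityˡ m))) (invPoch 2 m)) ⟩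
    qBinomialTerm 2 (mono 1) 1 m
      ∎

-- (t²;t⁴)_∞² F = (t²;t²)_∞ (-t;t²)_∞² = 2 Σ_n t^{n²} - 1
qPochInf²-⊛-F : (qPochInf 2 4 ⊛ qPochInf 2 4) ⊛ F ⊕ 𝟙 ≈ Θ ⊕ Θ
qPochInf²-⊛-F = ≈-trans (⊕-cong (≈-trans (⊛-congˡ (⊛-cong AB AB) F) product) (≈-refl {𝟙})) theta
  where
  A B Z I : PS
  A = qPochInf 1 2
  B = qPochInfPlus 1 2
  Z = qPochInf 2 2
  I = qPochInfInv 1 2
  AB : qPochInf 2 4 ≈ A ⊛ B
  AB = ≈-sym (qPochInf-⊛-qPochInfPlus 1 2 (s≤s z≤n) (s≤s z≤n))
  product : ((A ⊛ B) ⊛ (A ⊛ B)) ⊛ F ≈ Z ⊛ (euler₂Series 2 1 ⊛ euler₂Series 2 1)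
  product = begin
    ((A ⊛ B) ⊛ (A ⊛ B)) ⊛ F
      ≈⟨ solve 3 (λ a b f → ((a :* b) :* (a :* b)) :* f := (b :* b) :* (a :* (a :* f))) ≈-refl A B F ⟩
    (B ⊛ B) ⊛ (A ⊛ (A ⊛ F))
      ≈⟨ ⊛-congʳ (B ⊛ B) (⊛-congʳ A qPochInf-⊛-F) ⟩
    (B ⊛ B) ⊛ (A ⊛ (Z ⊛ I))
      ≈⟨ ⊛-congʳ (B ⊛ B) (solve 3 (λ a z i → a :* (z :* i) := z :* (a :* i)) ≈-refl A Z I) ⟩
    (B ⊛ B) ⊛ (Z ⊛ (A ⊛ I))
      ≈⟨ ⊛-congʳ (B ⊛ B) (≈-trans (⊛-congʳ Z (qPochInf-⊛-qPochInfInv 1 2 (s≤s z≤n) (s≤s z≤n))) (⊛-𝟙 Z)) ⟩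
    (B ⊛ B) ⊛ Z
      ≈⟨ ⊛-comm (B ⊛ B) Z ⟩
    Z ⊛ (B ⊛ B)
      ≈⟨ ⊛-congʳ Z (≈-sym (⊛-cong (euler₂ 2 1 (s≤s z≤n) (s≤s z≤n)) (euler₂ 2 1 (s≤s z≤n) (s≤s z≤n)))) ⟩
    Z ⊛ (euler₂Series 2 1 ⊛ euler₂Series 2 1)
      ∎
    where open ≈-Reasoning

Σ∞₂-⊛ : ∀ f g → SumConvergent₂ g → Σ∞₂ (λ i j → f ⊛ g i j) ≈ f ⊛ Σ∞₂ g
Σ∞₂-⊛ f g cv =
  ≈-trans (Σ∞-cong (λ i → ≈-sym (⊛-Σ∞ f {g i} (λ j → proj₂ (cv i j)))))
          (≈-sym (⊛-Σ∞ f {λ i → Σ∞ (g i)} (λ i → O-Σ∞ i (λ j → proj₁ (cv i j)))))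

SumConvergent₂-dilate : ∀ {g} → SumConvergent₂ g → SumConvergent₂ (λ i j → dilate (g i j))
SumConvergent₂-dilate cv i j = O-dilate i (proj₁ (cv i j)) , O-dilate j (proj₂ (cv i j))

Σ∞₂-interleave : ∀ c → SumConvergent₂ c →
  Σ∞₂ c ≈ (Σ∞₂ (λ i j → c (i +ℕ i) (j +ℕ j)) ⊕ Σ∞₂ (λ i j → c (i +ℕ i) (suc (j +ℕ j))))
        ⊕ (Σ∞₂ (λ i j → c (suc (i +ℕ i)) (j +ℕ j)) ⊕ Σ∞₂ (λ i j → c (suc (i +ℕ i)) (suc (j +ℕ j))))
Σ∞₂-interleave c cv = begin
  Σ∞₂ c
    ≈⟨ Σ∞-interleave (λ m → O-Σ∞ m (λ k → proj₁ (cv m k))) ⟩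
  Σ∞ (λ i → Σ∞ (c (i +ℕ i))) ⊕ Σ∞ (λ i → Σ∞ (c (suc (i +ℕ i))))
    ≈⟨ ⊕-cong (Σ∞-cong (λ i → Σ∞-interleave (λ k → proj₂ (cv (i +ℕ i) k))))
              (Σ∞-cong (λ i → Σ∞-interleave (λ k → proj₂ (cv (suc (i +ℕ i)) k)))) ⟩
  Σ∞ (λ i → Σ∞ (λ j → c (i +ℕ i) (j +ℕ j)) ⊕ Σ∞ (λ j → c (i +ℕ i) (suc (j +ℕ j))))
    ⊕ Σ∞ (λ i → Σ∞ (λ j → c (suc (i +ℕ i)) (j +ℕ j)) ⊕ Σ∞ (λ j → c (suc (i +ℕ i)) (suc (j +ℕ j))))
    ≈⟨ ⊕-cong (Σ∞-⊕ _ _) (Σ∞-⊕ _ _) ⟩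
  (Σ∞₂ (λ i j → c (i +ℕ i) (j +ℕ j)) ⊕ Σ∞₂ (λ i j → c (i +ℕ i) (suc (j +ℕ j))))
    ⊕ (Σ∞₂ (λ i j → c (suc (i +ℕ i)) (j +ℕ j)) ⊕ Σ∞₂ (λ i j → c (suc (i +ℕ i)) (suc (j +ℕ j))))
    ∎
  where open ≈-Reasoning

≤-by-≡ : ∀ {a b} c → b ≡ a +ℕ c → a ≤ b
≤-by-≡ {a} c b≡a+c = subst (a ≤_) (sym b≡a+c) (NP.m≤m+n a c)

pairTerm : ℕ → ℕ → ℕ → PS
pairTerm e a b = mono e ⊛ (invPoch 1 a ⊛ invPoch 1 b)

SumConvergent₂-pairTerm : ∀ (e a b : ℕ → ℕ → ℕ) → (∀ i j → i ≤ e i j × j ≤ e i j) →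
  SumConvergent₂ (λ i j → pairTerm (e i j) (a i j) (b i j))
SumConvergent₂-pairTerm e a b ≤e i j =
  O-mono-⊛-≤ (invPoch 1 (a i j) ⊛ invPoch 1 (b i j)) (proj₁ (≤e i j)) ,
  O-mono-⊛-≤ (invPoch 1 (a i j) ⊛ invPoch 1 (b i j)) (proj₂ (≤e i j))

dilate-invPoch : ∀ m → dilate (invPoch 1 m) ≈ invPoch 2 m
dilate-invPoch m = ≈-trans (dilate-prodTo m (λ k → inv1m (1 +ℕ 1 *ℕ k)))
  (prodTo-cong m (λ k _ → ≈-trans (dilate-inv1m (1 +ℕ 1 *ℕ k) (s≤s z≤n)) (inv1m-≡ (double k))))
  where
  double : ∀ k → (1 +ℕ 1 *ℕ k) +ℕ (1 +ℕ 1 *ℕ k) ≡ 2 +ℕ 2 *ℕ k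
  double = solveℕ

dilate-pairTerm : ∀ e a b → dilate (pairTerm e a b) ≈ mono (e +ℕ e) ⊛ (invPoch 2 a ⊛ invPoch 2 b)
dilate-pairTerm e a b = ≈-trans (dilate-⊛ (mono e) (invPoch 1 a ⊛ invPoch 1 b))
  (⊛-cong (dilate-mono e) (≈-trans (dilate-⊛ (invPoch 1 a) (invPoch 1 b)) (⊛-cong (dilate-invPoch a) (dilate-invPoch b))))

FTerm-even : ∀ e a b → 2 *ℕ a *ℕ b +ℕ a +ℕ b ≡ e +ℕ e → FTerm a b ≈ dilate (pairTerm e a b)
FTerm-even e a b exponent = ≈-trans (⊛-congˡ (mono-≡ exponent) (invPoch 2 a ⊛ invPoch 2 b)) (≈-sym (dilate-pairTerm e a b))

FTerm-odd : ∀ e a b → 2 *ℕ a *ℕ b +ℕ a +ℕ b ≡ 1 +ℕ (e +ℕ e) → FTerm a b ≈ mono 1 ⊛ dilate (pairTerm e a b)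
FTerm-odd e a b exponent = begin
  FTerm a b
    ≈⟨ ⊛-congˡ (mono-split _ 1 (e +ℕ e) exponent) (invPoch 2 a ⊛ invPoch 2 b) ⟩
  (mono 1 ⊛ mono (e +ℕ e)) ⊛ (invPoch 2 a ⊛ invPoch 2 b)
    ≈⟨ ⊛-assoc (mono 1) (mono (e +ℕ e)) (invPoch 2 a ⊛ invPoch 2 b) ⟩
  mono 1 ⊛ (mono (e +ℕ e) ⊛ (invPoch 2 a ⊛ invPoch 2 b))
    ≈⟨ ⊛-congʳ (mono 1) (≈-sym (dilate-pairTerm e a b)) ⟩
  mono 1 ⊛ dilate (pairTerm e a b)
    ∎
  where open ≈-Reasoning

evenExp oddExp summandExp : ℕ → ℕ → ℕ
evenExp    i j = 4 *ℕ i *ℕ j +ℕ i +ℕ j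
oddExp     i j = 4 *ℕ i *ℕ j +ℕ 3 *ℕ i +ℕ 3 *ℕ j +ℕ 2
summandExp i j = 4 *ℕ i *ℕ j +ℕ i +ℕ 3 *ℕ j

evenTerm oddTerm : ℕ → ℕ → PS
evenTerm i j = pairTerm (evenExp i j) (i +ℕ i) (j +ℕ j)
oddTerm  i j = pairTerm (oddExp i j) (suc (i +ℕ i)) (suc (j +ℕ j))

summand≈pairTerm : ∀ i j → summand i j ≈ pairTerm (summandExp i j) (suc (i +ℕ i)) (j +ℕ j)
summand≈pairTerm i j =
  ≈-trans (⊛-assoc (mono (summandExp i j)) (invPoch 1 (2 *ℕ i +ℕ 1)) (invPoch 1 (2 *ℕ j)))
          (⊛-congʳ (mono (summandExp i j)) (⊛-cong (≈-reflexive (cong (invPoch 1) (odd≡ i))) (≈-reflexive (cong (invPoch 1) (even≡ j)))))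
  where
  odd≡ : ∀ i → 2 *ℕ i +ℕ 1 ≡ suc (i +ℕ i)
  odd≡ = solveℕ
  even≡ : ∀ j → 2 *ℕ j ≡ j +ℕ j
  even≡ = solveℕ

SumConvergent₂-summand : SumConvergent₂ summand
SumConvergent₂-summand i j =
  O-resp-≈ (≈-sym (summand≈pairTerm i j)) (proj₁ pair) , O-resp-≈ (≈-sym (summand≈pairTerm i j)) (proj₂ pair)
  where
  pair = SumConvergent₂-pairTerm summandExp (λ i _ → suc (i +ℕ i)) (λ _ j → j +ℕ j)
           (λ i j → NP.≤-trans (NP.m≤n+m i (4 *ℕ i *ℕ j)) (NP.m≤m+n _ (3 *ℕ j)) ,
                    NP.≤-trans (NP.m≤n*m j 3) (NP.m≤n+m (3 *ℕ j) (4 *ℕ i *ℕ j +ℕ i))) i j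

SumConvergent₂-evenTerm : SumConvergent₂ evenTerm
SumConvergent₂-evenTerm = SumConvergent₂-pairTerm evenExp (λ i _ → i +ℕ i) (λ _ j → j +ℕ j)
  (λ i j → ≤-by-≡ (4 *ℕ i *ℕ j +ℕ j) (split i j) , NP.m≤n+m j (4 *ℕ i *ℕ j +ℕ i))
  where
  split : ∀ i j → 4 *ℕ i *ℕ j +ℕ i +ℕ j ≡ i +ℕ (4 *ℕ i *ℕ j +ℕ j)
  split = solveℕ

SumConvergent₂-oddTerm : SumConvergent₂ oddTerm
SumConvergent₂-oddTerm = SumConvergent₂-pairTerm oddExp (λ i _ → suc (i +ℕ i)) (λ _ j → suc (j +ℕ j))
  (λ i j → ≤-by-≡ _ (splitˡ i j) , ≤-by-≡ _ (splitʳ i j))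
  where
  splitˡ : ∀ i j → 4 *ℕ i *ℕ j +ℕ 3 *ℕ i +ℕ 3 *ℕ j +ℕ 2 ≡ i +ℕ (4 *ℕ i *ℕ j +ℕ 2 *ℕ i +ℕ 3 *ℕ j +ℕ 2)
  splitˡ = solveℕ
  splitʳ : ∀ i j → 4 *ℕ i *ℕ j +ℕ 3 *ℕ i +ℕ 3 *ℕ j +ℕ 2 ≡ j +ℕ (4 *ℕ i *ℕ j +ℕ 3 *ℕ i +ℕ 2 *ℕ j +ℕ 2)
  splitʳ = solveℕ

FTerm-even-even : ∀ i j → FTerm (i +ℕ i) (j +ℕ j) ≈ dilate (evenTerm i j)
FTerm-even-even i j = FTerm-even (evenExp i j) (i +ℕ i) (j +ℕ j) (exponent i j)
  where
  exponent : ∀ i j → 2 *ℕ (i +ℕ i) *ℕ (j +ℕ j) +ℕ (i +ℕ i) +ℕ (j +ℕ j)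
                     ≡ (4 *ℕ i *ℕ j +ℕ i +ℕ j) +ℕ (4 *ℕ i *ℕ j +ℕ i +ℕ j)
  exponent = solveℕ

FTerm-odd-odd : ∀ i j → FTerm (suc (i +ℕ i)) (suc (j +ℕ j)) ≈ dilate (oddTerm i j)
FTerm-odd-odd i j = FTerm-even (oddExp i j) (suc (i +ℕ i)) (suc (j +ℕ j)) (exponent i j)
  where
  exponent : ∀ i j → 2 *ℕ suc (i +ℕ i) *ℕ suc (j +ℕ j) +ℕ suc (i +ℕ i) +ℕ suc (j +ℕ j) 
                     ≡ (4 *ℕ i *ℕ j +ℕ 3 *ℕ i +ℕ 3 *ℕ j +ℕ 2) +ℕ (4 *ℕ i *ℕ j +ℕ 3 *ℕ i +ℕ 3 *ℕ j +ℕ 2)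
  exponent = solveℕ

FTerm-odd-even : ∀ i j → FTerm (suc (i +ℕ i)) (j +ℕ j) ≈ mono 1 ⊛ dilate (summand i j)
FTerm-odd-even i j =
  ≈-trans (FTerm-odd (summandExp i j) (suc (i +ℕ i)) (j +ℕ j) (exponent i j))
          (⊛-congʳ (mono 1) (dilate-cong (≈-sym (summand≈pairTerm i j))))
  where
  exponent : ∀ i j → 2 *ℕ suc (i +ℕ i) *ℕ (j +ℕ j) +ℕ suc (i +ℕ i) +ℕ (j +ℕ j) 
                     ≡ 1 +ℕ ((4 *ℕ i *ℕ j +ℕ i +ℕ 3 *ℕ j) +ℕ (4 *ℕ i *ℕ j +ℕ i +ℕ 3 *ℕ j))
  exponent = solveℕ

FTerm-even-odd : ∀ i j → FTerm (i +ℕ i) (suc (j +ℕ j)) ≈ mono 1 ⊛ dilate (summand j i)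
FTerm-even-odd i j =
  ≈-trans (⊛-cong (mono-≡ (transpose (i +ℕ i) (suc (j +ℕ j)))) (⊛-comm (invPoch 2 (i +ℕ i)) (invPoch 2 (suc (j +ℕ j)))))
          (FTerm-odd-even j i)
  where
  transpose : ∀ m k → 2 *ℕ m *ℕ k +ℕ m +ℕ k ≡ 2 *ℕ k *ℕ m +ℕ k +ℕ m
  transpose = solveℕ

Σ∞₂-dilate : ∀ g → SumConvergent₂ g → ∀ {c} → (∀ i j → c i j ≈ dilate (g i j)) → Σ∞₂ c ≈ dilate (Σ∞₂ g)
Σ∞₂-dilate g cv c≈ = ≈-trans (Σ∞-cong (λ i → Σ∞-cong (c≈ i))) (≈-sym (dilate-Σ∞₂ g cv))

Σ∞₂-mono1⊛dilate : ∀ g → SumConvergent₂ g → ∀ {c} → (∀ i j → c i j ≈ mono 1 ⊛ dilate (g i j)) →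
  Σ∞₂ c ≈ mono 1 ⊛ dilate (Σ∞₂ g)
Σ∞₂-mono1⊛dilate g cv {c} c≈ = begin
  Σ∞₂ c
    ≈⟨ Σ∞-cong (λ i → Σ∞-cong (c≈ i)) ⟩
  Σ∞₂ (λ i j → mono 1 ⊛ dilate (g i j))
    ≈⟨ Σ∞₂-⊛ (mono 1) (λ i j → dilate (g i j)) (SumConvergent₂-dilate cv) ⟩
  mono 1 ⊛ Σ∞₂ (λ i j → dilate (g i j))
    ≈⟨ ⊛-congʳ (mono 1) (≈-sym (dilate-Σ∞₂ g cv)) ⟩
  mono 1 ⊛ dilate (Σ∞₂ g)
    ∎
  where open ≈-Reasoning

F-parity : F ≈ dilate (Σ∞₂ evenTerm ⊕ Σ∞₂ oddTerm) ⊕ mono 1 ⊛ dilate (LHS ⊕ LHS)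
F-parity = begin
  F
    ≈⟨ Σ∞₂-interleave FTerm SumConvergent₂-FTerm ⟩
  (Σ∞₂ (λ i j → FTerm (i +ℕ i) (j +ℕ j)) ⊕ Σ∞₂ (λ i j → FTerm (i +ℕ i) (suc (j +ℕ j))))
    ⊕ (Σ∞₂ (λ i j → FTerm (suc (i +ℕ i)) (j +ℕ j)) ⊕ Σ∞₂ (λ i j → FTerm (suc (i +ℕ i)) (suc (j +ℕ j))))
    ≈⟨ ⊕-cong (⊕-cong (Σ∞₂-dilate evenTerm SumConvergent₂-evenTerm FTerm-even-even)
                      (Σ∞₂-mono1⊛dilate (λ i j → summand j i) SumConvergent₂-summandᵀ FTerm-even-odd))
              (⊕-cong (Σ∞₂-mono1⊛dilate summand SumConvergent₂-summand FTerm-odd-even)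
                      (Σ∞₂-dilate oddTerm SumConvergent₂-oddTerm FTerm-odd-odd)) ⟩
  (dilate (Σ∞₂ evenTerm) ⊕ mono 1 ⊛ dilate (Σ∞₂ (λ i j → summand j i))) ⊕ (mono 1 ⊛ dilate LHS ⊕ dilate (Σ∞₂ oddTerm))
    ≈⟨ ⊕-cong (⊕-cong (≈-refl {dilate (Σ∞₂ evenTerm)}) (⊛-congʳ (mono 1) (dilate-cong (Σ∞-swap (λ i j → summand j i)))))
              ≈-refl ⟩
  (dilate (Σ∞₂ evenTerm) ⊕ mono 1 ⊛ dilate LHS) ⊕ (mono 1 ⊛ dilate LHS ⊕ dilate (Σ∞₂ oddTerm))
    ≈⟨ solve 4 (λ a m l d → (a :+ m :* l) :+ (m :* l :+ d) := (a :+ d) :+ m :* (l :+ l)) ≈-refl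
         (dilate (Σ∞₂ evenTerm)) (mono 1) (dilate LHS) (dilate (Σ∞₂ oddTerm)) ⟩
  (dilate (Σ∞₂ evenTerm) ⊕ dilate (Σ∞₂ oddTerm)) ⊕ mono 1 ⊛ (dilate LHS ⊕ dilate LHS)
    ≈⟨ ⊕-cong (≈-sym (dilate-⊕ (Σ∞₂ evenTerm) (Σ∞₂ oddTerm))) (⊛-congʳ (mono 1) (≈-sym (dilate-⊕ LHS LHS))) ⟩
  dilate (Σ∞₂ evenTerm ⊕ Σ∞₂ oddTerm) ⊕ mono 1 ⊛ dilate (LHS ⊕ LHS)
    ∎
  where
  open ≈-Reasoning
  SumConvergent₂-summandᵀ : SumConvergent₂ (λ i j → summand j i)
  SumConvergent₂-summandᵀ i j = proj₂ (SumConvergent₂-summand j i) , proj₁ (SumConvergent₂-summand j i)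

Θ-parity : Θ ≈ dilate (Σ∞ (λ k → mono (2 *ℕ (k *ℕ k)))) ⊕ mono 1 ⊛ dilate (ψ 4)
Θ-parity = begin
  Θ
    ≈⟨ Σ∞-interleave (λ n → O-weaken (k≤k*k n) (O-mono (n *ℕ n))) ⟩
  Σ∞ (λ k → mono ((k +ℕ k) *ℕ (k +ℕ k))) ⊕ Σ∞ (λ k → mono (suc (k +ℕ k) *ℕ suc (k +ℕ k)))
    ≈⟨ ⊕-cong (Σ∞-cong (λ k → ≈-trans (mono-≡ (even-square k)) (≈-sym (dilate-mono (2 *ℕ (k *ℕ k))))))
              (Σ∞-cong (λ k → ≈-trans (mono-split _ 1 _ (odd-square k))
                                      (⊛-congʳ (mono 1) (≈-sym (dilate-mono (4 *ℕ tri (suc k))))))) ⟩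
  Σ∞ (λ k → dilate (mono (2 *ℕ (k *ℕ k)))) ⊕ Σ∞ (λ k → mono 1 ⊛ dilate (mono (4 *ℕ tri (suc k))))
    ≈⟨ ⊕-cong (≈-sym (dilate-Σ∞ cvθ))
              (≈-trans (≈-sym (⊛-Σ∞ (mono 1) (λ k → O-dilate k (cvψ k)))) (⊛-congʳ (mono 1) (≈-sym (dilate-Σ∞ cvψ)))) ⟩
  dilate (Σ∞ (λ k → mono (2 *ℕ (k *ℕ k)))) ⊕ mono 1 ⊛ dilate (ψ 4)
    ∎
  where
  open ≈-Reasoning
  cvθ : SumConvergent (λ k → mono (2 *ℕ (k *ℕ k)))
  cvθ k = O-weaken (NP.≤-trans (k≤k*k k) (NP.m≤m+n (k *ℕ k) (k *ℕ k +ℕ 0))) (O-mono (2 *ℕ (k *ℕ k)))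
  cvψ : SumConvergent (λ k → mono (4 *ℕ tri (suc k)))
  cvψ k = O-weaken (NP.≤-trans (NP.m≤n+m k (tri k)) (k≤c*k 4 (tri (suc k)) (s≤s z≤n))) (O-mono (4 *ℕ tri (suc k)))
  even-square : ∀ k → (k +ℕ k) *ℕ (k +ℕ k) ≡ 2 *ℕ (k *ℕ k) +ℕ 2 *ℕ (k *ℕ k)
  even-square = solveℕ
  odd-square : ∀ k → suc (k +ℕ k) *ℕ suc (k +ℕ k) ≡ 1 +ℕ (4 *ℕ tri (suc k) +ℕ 4 *ℕ tri (suc k))
  odd-square k = trans (expand k) (trans (cong (λ x → 1 +ℕ 4 *ℕ x +ℕ 4 *ℕ k) (sym (tri-double k))) (regroup k (tri k)))
    where
    expand : ∀ k → suc (k +ℕ k) *ℕ suc (k +ℕ k) ≡ 1 +ℕ 4 *ℕ (k *ℕ k) +ℕ 4 *ℕ k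
    expand = solveℕ
    regroup : ∀ k t → 1 +ℕ 4 *ℕ (k +ℕ 2 *ℕ t) +ℕ 4 *ℕ k ≡ 1 +ℕ (4 *ℕ (t +ℕ k) +ℕ 4 *ℕ (t +ℕ k))
    regroup = solveℕ

dilate-qPochInf : dilate (qPochInf 1 2) ≈ qPochInf 2 4
dilate-qPochInf = ≈-trans (dilate-infProd (ProdConvergent-oneMinus 1 2 (s≤s z≤n) (s≤s z≤n)))
                          (infProd-cong (λ k → ≈-trans (dilate-oneMinus (1 +ℕ 2 *ℕ k)) (oneMinus-≡ (double k))))
  where
  double : ∀ k → (1 +ℕ 2 *ℕ k) +ℕ (1 +ℕ 2 *ℕ k) ≡ 2 +ℕ 4 *ℕ k
  double = solveℕ

⊕-self-injective : ∀ X Y → X ⊕ X ≈ Y ⊕ Y → X ≈ Y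
⊕-self-injective X Y e = mk≈ λ n →
  ZP.*-cancelˡ-≡ (Z.+ 2) (X n) (Y n) (trans (sym (double (X n))) (trans (at e n) (double (Y n))))
  where
  double : ∀ x → x + x ≡ Z.+ 2 * x
  double = solve-∀

dilate-parts-⊛ : ∀ v a b →
  dilate v ⊛ (dilate a ⊕ mono 1 ⊛ dilate b) ⊕ 𝟙 ≈ dilate (v ⊛ a ⊕ 𝟙) ⊕ mono 1 ⊛ dilate (v ⊛ b)
dilate-parts-⊛ v a b = begin
  dilate v ⊛ (dilate a ⊕ mono 1 ⊛ dilate b) ⊕ 𝟙
    ≈⟨ ⊕-cong (≈-refl {dilate v ⊛ (dilate a ⊕ mono 1 ⊛ dilate b)}) (≈-sym dilate-𝟙) ⟩
  dilate v ⊛ (dilate a ⊕ mono 1 ⊛ dilate b) ⊕ dilate 𝟙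
    ≈⟨ solve 5 (λ v a m b o → v :* (a :+ m :* b) :+ o := (v :* a :+ o) :+ m :* (v :* b)) ≈-refl
         (dilate v) (dilate a) (mono 1) (dilate b) (dilate 𝟙) ⟩
  (dilate v ⊛ dilate a ⊕ dilate 𝟙) ⊕ mono 1 ⊛ (dilate v ⊛ dilate b)
    ≈⟨ ⊕-cong (≈-trans (⊕-cong (≈-sym (dilate-⊛ v a)) ≈-refl) (≈-sym (dilate-⊕ (v ⊛ a) 𝟙)))
              (⊛-congʳ (mono 1) (≈-sym (dilate-⊛ v b))) ⟩
  dilate (v ⊛ a ⊕ 𝟙) ⊕ mono 1 ⊛ dilate (v ⊛ b)
    ∎
  where open ≈-Reasoning

dilate-parts-⊕ : ∀ a b →
  (dilate a ⊕ mono 1 ⊛ dilate b) ⊕ (dilate a ⊕ mono 1 ⊛ dilate b) ≈ dilate (a ⊕ a) ⊕ mono 1 ⊛ dilate (b ⊕ b)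
dilate-parts-⊕ a b = begin
  (dilate a ⊕ mono 1 ⊛ dilate b) ⊕ (dilate a ⊕ mono 1 ⊛ dilate b)
    ≈⟨ solve 3 (λ a m b → (a :+ m :* b) :+ (a :+ m :* b) := (a :+ a) :+ m :* (b :+ b)) ≈-refl (dilate a) (mono 1) (dilate b) ⟩
  (dilate a ⊕ dilate a) ⊕ mono 1 ⊛ (dilate b ⊕ dilate b)
    ≈⟨ ⊕-cong (≈-sym (dilate-⊕ a a)) (⊛-congʳ (mono 1) (≈-sym (dilate-⊕ b b))) ⟩
  dilate (a ⊕ a) ⊕ mono 1 ⊛ dilate (b ⊕ b)
    ∎
  where open ≈-Reasoning

-- The odd parts of the two sides of qPochInf²-⊛-F.
qPochInf²-⊛-LHS : (qPochInf 1 2 ⊛ qPochInf 1 2) ⊛ LHS ≈ ψ 4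
qPochInf²-⊛-LHS = ⊕-self-injective (v ⊛ LHS) (ψ 4) (begin
  v ⊛ LHS ⊕ v ⊛ LHS
    ≈⟨ ≈-sym (⊛-distribˡ LHS LHS v) ⟩
  v ⊛ (LHS ⊕ LHS)
    ≈⟨ ≈-sym (oddPart-dilate (v ⊛ E ⊕ 𝟙) (v ⊛ (LHS ⊕ LHS))) ⟩
  oddPart (dilate (v ⊛ E ⊕ 𝟙) ⊕ mono 1 ⊛ dilate (v ⊛ (LHS ⊕ LHS)))
    ≈⟨ oddPart-cong (≈-sym (≈-trans (⊕-cong (⊛-congʳ (dilate v) F-parity) ≈-refl)
        (dilate-parts-⊛ v E (LHS ⊕ LHS)))) ⟩
  oddPart (dilate v ⊛ F ⊕ 𝟙)
    ≈⟨ oddPart-cong (⊕-cong (⊛-congˡ dilate-v F) (≈-refl {𝟙})) ⟩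
  oddPart ((qPochInf 2 4 ⊛ qPochInf 2 4) ⊛ F ⊕ 𝟙)
    ≈⟨ oddPart-cong qPochInf²-⊛-F ⟩
  oddPart (Θ ⊕ Θ)
    ≈⟨ oddPart-cong (≈-trans (⊕-cong Θ-parity Θ-parity) (dilate-parts-⊕ θ (ψ 4))) ⟩
  oddPart (dilate (θ ⊕ θ) ⊕ mono 1 ⊛ dilate (ψ 4 ⊕ ψ 4))
    ≈⟨ oddPart-dilate (θ ⊕ θ) (ψ 4 ⊕ ψ 4) ⟩
  ψ 4 ⊕ ψ 4
    ∎)
  where
  open ≈-Reasoning
  v E θ : PS
  v = qPochInf 1 2 ⊛ qPochInf 1 2
  E = Σ∞₂ evenTerm ⊕ Σ∞₂ oddTerm
  θ = Σ∞ (λ k → mono (2 *ℕ (k *ℕ k)))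
  dilate-v : dilate v ≈ qPochInf 2 4 ⊛ qPochInf 2 4
  dilate-v = ≈-trans (dilate-⊛ (qPochInf 1 2) (qPochInf 1 2)) (⊛-cong dilate-qPochInf dilate-qPochInf)

-- Products of q-Pochhammer symbols

qPochInf-interleave : ∀ s → 1 ≤ s → qPochInf s s ≈ qPochInf s (s +ℕ s) ⊛ qPochInf (s +ℕ s) (s +ℕ s)
qPochInf-interleave s s≥1 =
  ≈-trans (infProd-interleave (ProdConvergent-oneMinus s s s≥1 s≥1))
          (⊛-cong (infProd-cong (λ k → oneMinus-≡ (even-index s k))) (infProd-cong (λ k → oneMinus-≡ (odd-index s k))))
  where
  even-index : ∀ s k → s +ℕ s *ℕ (k +ℕ k) ≡ s +ℕ (s +ℕ s) *ℕ k
  even-index = solveℕ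
  odd-index : ∀ s k → s +ℕ s *ℕ suc (k +ℕ k) ≡ (s +ℕ s) +ℕ (s +ℕ s) *ℕ k
  odd-index = solveℕ

-- Times (q^{2s};q^{2s})_∞, the left side becomes (q^s;q^s)_∞ (-q^s;q^s)_∞ = (q^{2s};q^{2s})_∞.
qPochInf-⊛-qPochInfPlus-odd : ∀ s → 1 ≤ s → qPochInf s (s +ℕ s) ⊛ qPochInfPlus s s ≈ 𝟙
qPochInf-⊛-qPochInfPlus-odd s s≥1 = begin
  A ⊛ P                        ≈⟨ ≈-sym (⊛-𝟙 (A ⊛ P)) ⟩
  (A ⊛ P) ⊛ 𝟙                  ≈⟨ ⊛-congʳ (A ⊛ P) (≈-sym (qPochInf-⊛-qPochInfInv (s +ℕ s) (s +ℕ s) 2s≥1 2s≥1)) ⟩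
  (A ⊛ P) ⊛ (B ⊛ I)            ≈⟨ solve 4 (λ a p b i → (a :* p) :* (b :* i) := ((a :* b) :* p) :* i) ≈-refl A P B I ⟩
  ((A ⊛ B) ⊛ P) ⊛ I            ≈⟨ ⊛-congˡ (⊛-congˡ (≈-sym (qPochInf-interleave s s≥1)) P) I ⟩
  (qPochInf s s ⊛ P) ⊛ I       ≈⟨ ⊛-congˡ (qPochInf-⊛-qPochInfPlus s s s≥1 s≥1) I ⟩
  B ⊛ I                        ≈⟨ qPochInf-⊛-qPochInfInv (s +ℕ s) (s +ℕ s) 2s≥1 2s≥1 ⟩
  𝟙                            ∎
  where
  open ≈-Reasoning
  A P B I : PS
  A = qPochInf s (s +ℕ s)
  P = qPochInfPlus s s
  B = qPochInf (s +ℕ s) (s +ℕ s)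
  I = qPochInfInv (s +ℕ s) (s +ℕ s)
  2s≥1 : 1 ≤ s +ℕ s
  2s≥1 = NP.≤-trans s≥1 (NP.m≤m+n s s)

ψ-product : ∀ s → 1 ≤ s → ψ s ≈ qPochInf (s +ℕ s) (s +ℕ s) ⊛ qPochInfInv s (s +ℕ s)
ψ-product s s≥1 = begin
  ψ s
    ≈⟨ ≈-sym (gauss s s≥1) ⟩
  qPochInf s s ⊛ (E ⊛ E)
    ≈⟨ ⊛-cong (qPochInf-interleave s s≥1) (⊛-cong (euler₂ s s s≥1 s≥1) (euler₂ s s s≥1 s≥1)) ⟩
  (A ⊛ B) ⊛ (P ⊛ P)
    ≈⟨ solve 3 (λ a b p → (a :* b) :* (p :* p) := b :* ((a :* p) :* p)) ≈-refl A B P ⟩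
  B ⊛ ((A ⊛ P) ⊛ P)
    ≈⟨ ⊛-congʳ B (≈-trans (⊛-congˡ (qPochInf-⊛-qPochInfPlus-odd s s≥1) P) (𝟙-⊛ P)) ⟩
  B ⊛ P
    ≈⟨ ⊛-congʳ B (inverse-unique P I A (≈-trans (⊛-comm P A) (qPochInf-⊛-qPochInfPlus-odd s s≥1))
        (≈-trans (⊛-comm I A) (qPochInf-⊛-qPochInfInv s (s +ℕ s) s≥1 2s≥1))) ⟩
  B ⊛ I
    ∎
  where
  open ≈-Reasoning
  E A B P I : PS
  E = euler₂Series s s
  A = qPochInf s (s +ℕ s)
  B = qPochInf (s +ℕ s) (s +ℕ s)
  P = qPochInfPlus s s
  I = qPochInfInv s (s +ℕ s)
  2s≥1 : 1 ≤ s +ℕ s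
  2s≥1 = NP.≤-trans s≥1 (NP.m≤m+n s s)

theorem1p2 : (n : ℕ) → LHS n ≡ RHS n
theorem1p2 = at (begin
  LHS
    ≈⟨ ≈-sym (⊛-𝟙 LHS) ⟩
  LHS ⊛ 𝟙
    ≈⟨ ⊛-congʳ LHS (≈-sym (≈-trans (⊛-cong A⊛I≈𝟙 A⊛I≈𝟙) (𝟙-⊛ 𝟙))) ⟩
  LHS ⊛ ((A ⊛ I) ⊛ (A ⊛ I))
    ≈⟨ solve 3 (λ l a i → l :* ((a :* i) :* (a :* i)) := ((a :* a) :* l) :* (i :* i)) ≈-refl LHS A I ⟩
  ((A ⊛ A) ⊛ LHS) ⊛ (I ⊛ I)
    ≈⟨ ⊛-congˡ (≈-trans qPochInf²-⊛-LHS (ψ-product 4 (s≤s z≤n))) (I ⊛ I) ⟩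
  (qPochInf 8 8 ⊛ qPochInfInv 4 8) ⊛ (I ⊛ I)
    ≈⟨ solve 3 (λ b c i → (b :* c) :* (i :* i) := b :* ((i :* i) :* c)) ≈-refl (qPochInf 8 8) (qPochInfInv 4 8) I ⟩
  RHS
    ∎)
  where
  open ≈-Reasoning
  A I : PS
  A = qPochInf 1 2
  I = qPochInfInv 1 2
  A⊛I≈𝟙 : A ⊛ I ≈ 𝟙
  A⊛I≈𝟙 = qPochInf-⊛-qPochInfInv 1 2 (s≤s z≤n) (s≤s z≤n)
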